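{- Let $(a_1,\dots,a_{12})=(1,\beta,-2\beta^{2},5\beta^{3},\beta^{4},10\beta^{5},\beta^{6},5\beta^{7},-2\beta^{8},\beta^{9},\beta^{10},2\beta^{11})$. Then \[ \sum_{k=0}^\infty\frac{1}{\alpha^{12k}}\sum_{j=1}^{12}\frac{a_j}{12k+j}=0. \]
   Context: $\alpha=(1+\sqrt5)/2$ is the golden ratio and $\beta=-1/\alpha=(1-\sqrt5)/2$. -}

module Defs where

open import Data.Nat as ℕ using (ℕ; zero; suc)
open import Data.Integer using (ℤ; +_; -[1+_])
open import Data.Rational
  using (ℚ; 0ℚ; 1ℚ; _+_; _*_; _-_; -_; _÷_; _<_; _≤_; _≟_; ≢-nonZero)
  renaming (_/_ to _/ℚ_)
open import Data.Product using (_×_; _,_)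
open import Data.Sum using (_⊎_)
open import Relation.Nullary using (yes; no)

record ℚ√5 : Set where
  constructor _+_√5
  field
    re : ℚ
    im : ℚ
open ℚ√5 public

five : ℚ
five = + 5 /ℚ 1

half : ℚ
half = + 1 /ℚ 2

0q : ℚ√5
0q = 0ℚ + 0ℚ √5

1q : ℚ√5
1q = 1ℚ + 0ℚ √5

fromℚ : ℚ → ℚ√5
fromℚ q = q + 0ℚ √5

_⊕_ : ℚ√5 → ℚ√5 → ℚ√5
(a + b √5) ⊕ (c + d √5) = (a + c) + (b + d) √5

⊖_ : ℚ√5 → ℚ√5
⊖ (a + b √5) = (- a) + (- b) √5

_⊖_ : ℚ√5 → ℚ√5 → ℚ√5
x ⊖ y = x ⊕ (⊖ y)

_⊗_ : ℚ√5 → ℚ√5 → ℚ√5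
(a + b √5) ⊗ (c + d √5) = (a * c + five * (b * d)) + (a * d + b * c) √5

_^_ : ℚ√5 → ℕ → ℚ√5
x ^ zero  = 1q
x ^ suc n = x ⊗ (x ^ n)

-- Multiplicative inverse: (a + b√5)⁻¹ = (a - b√5)/(a² - 5b²);
-- by convention 0⁻¹ = 0 (the norm a² - 5b² vanishes only at 0, as √5 ∉ ℚ).
recip : ℚ√5 → ℚ√5
recip (a + b √5) with (a * a - five * (b * b)) ≟ 0ℚ
... | yes _ = 0q
... | no N≢0 =
  let instance _ = ≢-nonZero N≢0 in
  (a ÷ (a * a - five * (b * b))) + ((- b) ÷ (a * a - five * (b * b))) √5

-- Strict positivity of a + b√5 as a real number.
Pos : ℚ√5 → Set
Pos (a + b √5) =
    (0ℚ ≤ a × 0ℚ ≤ b × (0ℚ < a ⊎ 0ℚ < b))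
  ⊎ (0ℚ < a × b < 0ℚ × five * (b * b) < a * a)
  ⊎ (a < 0ℚ × 0ℚ < b × a * a < five * (b * b))

AbsLt : ℚ√5 → ℚ → Set
AbsLt x ε = Pos (fromℚ ε ⊖ x) × Pos (fromℚ ε ⊕ x)

α : ℚ√5
α = half + half √5

β : ℚ√5
β = half + (- half) √5

Σ< : ℕ → (ℕ → ℚ√5) → ℚ√5
Σ< zero    f = 0q
Σ< (suc n) f = Σ< n f ⊕ f n

-- The coefficients a_j = c_j β^(j-1), j = 1..12, with
-- (c_1,…,c_12) = (1, 1, -2, 5, 1, 10, 1, 5, -2, 1, 1, 2).
-- Here indexed by i = j - 1 ∈ {0,…,11}; c i = 0 for i ≥ 12 (unused).

c : ℕ → ℤ
c 0  = + 1
c 1  = + 1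
c 2  = -[1+ 1 ]
c 3  = + 5
c 4  = + 1
c 5  = + 10
c 6  = + 1
c 7  = + 5
c 8  = -[1+ 1 ]
c 9  = + 1
c 10 = + 1
c 11 = + 2
c _  = + 0

a : ℕ → ℚ√5
a i = fromℚ (c i /ℚ 1) ⊗ (β ^ i)

inner : ℕ → ℚ√5
inner k = Σ< 12 (λ i → fromℚ (+ 1 /ℚ suc (12 ℕ.* k ℕ.+ i)) ⊗ a i)

term : ℕ → ℚ√5
term k = recip (α ^ (12 ℕ.* k)) ⊗ inner k

S : ℕ → ℚ√5
S n = Σ< n term

SeriesSumsTo : (ℕ → ℚ√5) → ℚ√5 → Set
SeriesSumsTo t v =
  (ε : ℚ) → 0ℚ < ε →
  Data.Product.∃ λ N → (n : ℕ) → N ℕ.≤ n → AbsLt (Σ< n t ⊖ v) ε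

{-# OPTIONS --safe #-}
module Submission where

-- Multiplied by β, the n-th partial sum is  Σ_{m ≤ 12n} c_m βᵐ/m  with 12-periodic coefficients, and
-- c_m = 1 - 3[3 ∣ m] + 4[4 ∣ m] + 12[6 ∣ m] - 12[12 ∣ m]  turns it into the combination
-- L(β) - L(β³) + L(β⁴) + 2 L(β⁶) - L(β¹²)  of truncations of  L(y) = Σ yᵏ/k = -log(1 - y).  The limit is
-- therefore  -log((1 - β)(1 - β⁴)(1 - β⁶)² / ((1 - β³)(1 - β¹²))) = -log 1 = 0.
-- There are no real logarithms here: instead, L(x) + L(y) = L(x + y - xy) is proved for truncations up to
-- an error decaying geometrically in the truncation length, by comparing coefficients of
-- -log(1 - (x + y) t + xy t²) = -log(1 - x t) - log(1 - y t) as power series in t.  All inequalities in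
-- ℚ(√5) are certified by rational sign conditions on the coordinates after multiplication by a power of
-- the unit 9 + 4√5.

open import Defs
open import Level using (0ℓ)
open import Data.Nat as ℕ using (ℕ; zero; suc; z≤n; s≤s)
import Data.Nat.Properties as ℕ
open import Data.Integer using (+_; -[1+_])
open import Data.Rational as ℚ
  using (ℚ; 0ℚ; 1ℚ; _+_; _*_; _-_; -_; _≤_; _<_; _÷_; ≢-nonZero; mkℚ)
  renaming (_/_ to _/ℚ_)
import Data.Rational.Properties as ℚ
open import Data.Rational.Unnormalised as ℚᵘ using (mkℚᵘ; *≡*; *<*)
import Data.Rational.Unnormalised.Properties as ℚᵘ
import Data.Integer as ℤ
import Data.Integer.Properties as ℤ
open import Data.Rational.Solver using (module +-*-Solver)
open import Data.Product using (Σ; _×_; _,_; proj₁; proj₂)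
open import Data.Sum using (inj₁; inj₂)
open import Data.Empty using (⊥-elim)
open import Relation.Nullary using (Dec; yes; no)
open import Relation.Nullary.Decidable using (True; toWitness)
open import Relation.Binary.Definitions using (Tri; tri<; tri≈; tri>)
open import Relation.Binary.PropositionalEquality
open import Algebra.Bundles using (CommutativeRing)
open import Algebra.Structures using (IsCommutativeRing)
import Algebra.Solver.Ring.Simple as RingSolver
import Algebra.Solver.Ring.AlmostCommutativeRing as ACR
open import Data.Nat.Tactic.RingSolver using (solve-∀)
open import Data.List using (List; _∷_; []; map; foldl)
open import Algebra.Properties.CommutativeSemiring.Exp (CommutativeRing.commutativeSemiring ℚ.+-*-commutativeRing)
  using () renaming (_^_ to infixr 8 _^ℚ_; ^-homo-* to ^ℚ-+)

≡-√5 : ∀ {a b c d} → a ≡ c → b ≡ d → a + b √5 ≡ c + d √5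
≡-√5 refl refl = refl

module _ where
  open +-*-Solver

  ⊗-comm : ∀ x y → x ⊗ y ≡ y ⊗ x
  ⊗-comm (a + b √5) (c + d √5) = ≡-√5 (re-comm a b c d) (im-comm a b c d)
    where
    re-comm : ∀ a b c d → a * c + five * (b * d) ≡ c * a + five * (d * b)
    re-comm = solve 4 (λ a b c d → a :* c :+ con five :* (b :* d) := c :* a :+ con five :* (d :* b)) refl
    im-comm : ∀ a b c d → a * d + b * c ≡ c * b + d * a
    im-comm = solve 4 (λ a b c d → a :* d :+ b :* c := c :* b :+ d :* a) refl

  ⊗-assoc : ∀ x y z → (x ⊗ y) ⊗ z ≡ x ⊗ (y ⊗ z)
  ⊗-assoc (a + b √5) (c + d √5) (e + f √5) = ≡-√5 (re-assoc a b c d e f) (im-assoc a b c d e f)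
    where
    re-assoc : ∀ a b c d e f → (a * c + five * (b * d)) * e + five * ((a * d + b * c) * f)
                             ≡ a * (c * e + five * (d * f)) + five * (b * (c * f + d * e))
    re-assoc = solve 6 (λ a b c d e f → (a :* c :+ con five :* (b :* d)) :* e :+ con five :* ((a :* d :+ b :* c) :* f)
                             := a :* (c :* e :+ con five :* (d :* f)) :+ con five :* (b :* (c :* f :+ d :* e))) refl
    im-assoc : ∀ a b c d e f → (a * c + five * (b * d)) * f + (a * d + b * c) * e
                             ≡ a * (c * f + d * e) + b * (c * e + five * (d * f))
    im-assoc = solve 6 (λ a b c d e f → (a :* c :+ con five :* (b :* d)) :* f :+ (a :* d :+ b :* c) :* e
                             := a :* (c :* f :+ d :* e) :+ b :* (c :* e :+ con five :* (d :* f))) refl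

  ⊗-identityˡ : ∀ x → 1q ⊗ x ≡ x
  ⊗-identityˡ (a + b √5) = ≡-√5 (re-identity a b) (im-identity a b)
    where
    re-identity : ∀ a b → 1ℚ * a + five * (0ℚ * b) ≡ a
    re-identity = solve 2 (λ a b → con 1ℚ :* a :+ con five :* (con 0ℚ :* b) := a) refl
    im-identity : ∀ a b → 1ℚ * b + 0ℚ * a ≡ b
    im-identity = solve 2 (λ a b → con 1ℚ :* b :+ con 0ℚ :* a := b) refl

  ⊗-distribˡ-⊕ : ∀ x y z → x ⊗ (y ⊕ z) ≡ (x ⊗ y) ⊕ (x ⊗ z)
  ⊗-distribˡ-⊕ (a + b √5) (c + d √5) (e + f √5) = ≡-√5 (re-distrib a b c d e f) (im-distrib a b c d e f)
    where
    re-distrib : ∀ a b c d e f → a * (c + e) + five * (b * (d + f))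
                               ≡ (a * c + five * (b * d)) + (a * e + five * (b * f))
    re-distrib = solve 6 (λ a b c d e f → a :* (c :+ e) :+ con five :* (b :* (d :+ f))
                               := (a :* c :+ con five :* (b :* d)) :+ (a :* e :+ con five :* (b :* f))) refl
    im-distrib : ∀ a b c d e f → a * (d + f) + b * (c + e) ≡ (a * d + b * c) + (a * f + b * e)
    im-distrib = solve 6 (λ a b c d e f → a :* (d :+ f) :+ b :* (c :+ e) := (a :* d :+ b :* c) :+ (a :* f :+ b :* e)) refl

ℚ√5-isCommutativeRing : IsCommutativeRing _≡_ _⊕_ _⊗_ ⊖_ 0q 1q
ℚ√5-isCommutativeRing = record
  { isRing = record
    { +-isAbelianGroup = record
      { isGroup = record
        { isMonoid = record
          { isSemigroup = record
            { isMagma = record { isEquivalence = isEquivalence ; ∙-cong = cong₂ _⊕_ }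
            ; assoc = λ x y z → ≡-√5 (ℚ.+-assoc (re x) (re y) (re z)) (ℚ.+-assoc (im x) (im y) (im z)) }
          ; identity = (λ x → ≡-√5 (ℚ.+-identityˡ (re x)) (ℚ.+-identityˡ (im x)))
                     , (λ x → ≡-√5 (ℚ.+-identityʳ (re x)) (ℚ.+-identityʳ (im x))) }
        ; inverse = (λ x → ≡-√5 (ℚ.+-inverseˡ (re x)) (ℚ.+-inverseˡ (im x)))
                  , (λ x → ≡-√5 (ℚ.+-inverseʳ (re x)) (ℚ.+-inverseʳ (im x)))
        ; ⁻¹-cong = cong (⊖_) }
      ; comm = λ x y → ≡-√5 (ℚ.+-comm (re x) (re y)) (ℚ.+-comm (im x) (im y)) }
    ; *-cong = cong₂ _⊗_
    ; *-assoc = ⊗-assoc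
    ; *-identity = ⊗-identityˡ , (λ x → trans (⊗-comm x 1q) (⊗-identityˡ x))
    ; distrib = ⊗-distribˡ-⊕
              , (λ x y z → trans (⊗-comm (y ⊕ z) x) (trans (⊗-distribˡ-⊕ x y z) (cong₂ _⊕_ (⊗-comm x y) (⊗-comm x z)))) }
  ; *-comm = ⊗-comm }

ℚ√5-commutativeRing : CommutativeRing 0ℓ 0ℓ
ℚ√5-commutativeRing = record { isCommutativeRing = ℚ√5-isCommutativeRing }

open CommutativeRing ℚ√5-commutativeRing
  using () renaming (+-assoc to ⊕-assoc; +-identityˡ to ⊕-identityˡ; +-identityʳ to ⊕-identityʳ; *-identityʳ to ⊗-identityʳ; zeroʳ to ⊗-zeroʳ)

_≟_ : (x y : ℚ√5) → Dec (x ≡ y)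
(a + b √5) ≟ (c + d √5) with a ℚ.≟ c | b ℚ.≟ d
... | yes refl | yes refl = yes refl
... | no a≢c   | _        = no (λ x≡y → a≢c (cong re x≡y))
... | yes _    | no b≢d   = no (λ x≡y → b≢d (cong im x≡y))

module ℚ√5-Solver = RingSolver (ACR.fromCommutativeRing ℚ√5-commutativeRing) _≟_

^-+ : ∀ x m n → x ^ (m ℕ.+ n) ≡ (x ^ m) ⊗ (x ^ n)
^-+ x zero    n = sym (⊗-identityˡ (x ^ n))
^-+ x (suc m) n = trans (cong (x ⊗_) (^-+ x m n)) (sym (⊗-assoc x (x ^ m) (x ^ n)))

^-* : ∀ x m n → (x ^ m) ^ n ≡ x ^ (m ℕ.* n)
^-* x m zero    = cong (x ^_) (sym (ℕ.*-zeroʳ m))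
^-* x m (suc n) = begin
  (x ^ m) ⊗ ((x ^ m) ^ n)   ≡⟨ cong ((x ^ m) ⊗_) (^-* x m n) ⟩
  (x ^ m) ⊗ (x ^ (m ℕ.* n)) ≡⟨ sym (^-+ x m (m ℕ.* n)) ⟩
  x ^ (m ℕ.+ m ℕ.* n)       ≡⟨ cong (x ^_) (sym (ℕ.*-suc m n)) ⟩
  x ^ (m ℕ.* suc n)         ∎
  where open ≡-Reasoning

^-distrib-⊗ : ∀ x y n → (x ⊗ y) ^ n ≡ (x ^ n) ⊗ (y ^ n)
^-distrib-⊗ x y zero    = refl
^-distrib-⊗ x y (suc n) = trans (cong ((x ⊗ y) ⊗_) (^-distrib-⊗ x y n)) (interchange x y (x ^ n) (y ^ n))
  where
  open ℚ√5-Solver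
  interchange : ∀ a b c d → (a ⊗ b) ⊗ (c ⊗ d) ≡ (a ⊗ c) ⊗ (b ⊗ d)
  interchange = solve 4 (λ a b c d → (a :* b) :* (c :* d) := (a :* c) :* (b :* d)) refl

1^ : ∀ n → 1q ^ n ≡ 1q
1^ zero    = refl
1^ (suc n) = trans (⊗-identityˡ (1q ^ n)) (1^ n)

norm : ℚ√5 → ℚ
norm (a + b √5) = a * a - five * (b * b)

norm-⊗ : ∀ x y → norm (x ⊗ y) ≡ norm x * norm y
norm-⊗ (a + b √5) (c + d √5) = expand a b c d
  where
  open +-*-Solver
  expand : ∀ a b c d → (a * c + five * (b * d)) * (a * c + five * (b * d)) - five * ((a * d + b * c) * (a * d + b * c))
                     ≡ (a * a - five * (b * b)) * (c * c - five * (d * d))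
  expand = solve 4 (λ a b c d → (a :* c :+ con five :* (b :* d)) :* (a :* c :+ con five :* (b :* d))
                                  :- con five :* ((a :* d :+ b :* c) :* (a :* d :+ b :* c))
                              := (a :* a :- con five :* (b :* b)) :* (c :* c :- con five :* (d :* d))) refl

-- recip branches on the norm, which is multiplicative, so on a unit it never takes the junk branch 0⁻¹ = 0.
recip-unique : ∀ x y → x ⊗ y ≡ 1q → recip x ≡ y
recip-unique (a + b √5) y xy≡1 with a * a - five * (b * b) ℚ.≟ 0ℚ
... | yes N≡0 = ⊥-elim (ℚ.1≢0 (begin
  1ℚ                        ≡⟨ cong norm (sym xy≡1) ⟩
  norm ((a + b √5) ⊗ y)     ≡⟨ norm-⊗ (a + b √5) y ⟩
  norm (a + b √5) * norm y  ≡⟨ cong (_* norm y) N≡0 ⟩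
  0ℚ * norm y               ≡⟨ ℚ.*-zeroˡ (norm y) ⟩
  0ℚ                        ∎))
  where open ≡-Reasoning
... | no N≢0 = begin
  x⁻¹                ≡⟨ sym (⊗-identityʳ x⁻¹) ⟩
  x⁻¹ ⊗ 1q           ≡⟨ cong (x⁻¹ ⊗_) (sym xy≡1) ⟩
  x⁻¹ ⊗ (x ⊗ y)      ≡⟨ sym (⊗-assoc x⁻¹ x y) ⟩
  (x⁻¹ ⊗ x) ⊗ y      ≡⟨ cong (_⊗ y) (trans (⊗-comm x⁻¹ x) x⊗x⁻¹≡1) ⟩
  1q ⊗ y             ≡⟨ ⊗-identityˡ y ⟩
  y                  ∎
  where
  open ≡-Reasoning
  instance _ = ≢-nonZero N≢0
  N = a * a - five * (b * b)
  x = a + b √5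
  x⁻¹ = (a ÷ N) + ((- b) ÷ N) √5
  x⊗x⁻¹≡1 : x ⊗ x⁻¹ ≡ 1q
  x⊗x⁻¹≡1 = ≡-√5 (trans (re-expand a b (ℚ.1/ N)) (ℚ.*-inverseʳ N)) (im-expand a b (ℚ.1/ N))
    where
    open +-*-Solver
    re-expand : ∀ a b i → a * (a * i) + five * (b * (- b * i)) ≡ (a * a - five * (b * b)) * i
    re-expand = solve 3 (λ a b i → a :* (a :* i) :+ con five :* (b :* (:- b :* i)) := (a :* a :- con five :* (b :* b)) :* i) refl
    im-expand : ∀ a b i → a * (- b * i) + b * (a * i) ≡ 0ℚ
    im-expand = solve 3 (λ a b i → a :* (:- b :* i) :+ b :* (a :* i) := con 0ℚ) refl

fromℚ-* : ∀ p q → fromℚ (p * q) ≡ fromℚ p ⊗ fromℚ q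
fromℚ-* p q = ≡-√5 (re-expand p q) (im-expand p q)
  where
  open +-*-Solver
  re-expand : ∀ p q → p * q ≡ p * q + five * (0ℚ * 0ℚ)
  re-expand = solve 2 (λ p q → p :* q := p :* q :+ con five :* (con 0ℚ :* con 0ℚ)) refl
  im-expand : ∀ p q → 0ℚ ≡ p * 0ℚ + 0ℚ * q
  im-expand = solve 2 (λ p q → con 0ℚ := p :* con 0ℚ :+ con 0ℚ :* q) refl

module _ {p q : ℚ} where

  nonNeg+nonNeg : 0ℚ ≤ p → 0ℚ ≤ q → 0ℚ ≤ p + q
  nonNeg+nonNeg 0≤p 0≤q = ℚ.+-mono-≤ 0≤p 0≤q

  pos+nonNeg : 0ℚ < p → 0ℚ ≤ q → 0ℚ < p + q
  pos+nonNeg 0<p 0≤q = ℚ.+-mono-<-≤ 0<p 0≤q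

  nonNeg+pos : 0ℚ ≤ p → 0ℚ < q → 0ℚ < p + q
  nonNeg+pos 0≤p 0<q = ℚ.+-mono-≤-< 0≤p 0<q

  nonNeg*nonNeg : 0ℚ ≤ p → 0ℚ ≤ q → 0ℚ ≤ p * q
  nonNeg*nonNeg 0≤p 0≤q = ℚ.nonNegative⁻¹ _ {{ℚ.nonNeg*nonNeg⇒nonNeg p {{ℚ.nonNegative 0≤p}} q {{ℚ.nonNegative 0≤q}}}}

  pos*pos : 0ℚ < p → 0ℚ < q → 0ℚ < p * q
  pos*pos 0<p 0<q = ℚ.positive⁻¹ _ {{ℚ.pos*pos⇒pos p {{ℚ.positive 0<p}} q {{ℚ.positive 0<q}}}}

  pos-cancelˡ : 0ℚ ≤ p → 0ℚ < p * q → 0ℚ < q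
  pos-cancelˡ 0≤p 0<pq = ℚ.*-cancelˡ-<-nonNeg p {{ℚ.nonNegative 0≤p}} (subst (_< p * q) (sym (ℚ.*-zeroʳ p)) 0<pq)

  p≤q⇒0≤q-p : p ≤ q → 0ℚ ≤ q - p
  p≤q⇒0≤q-p p≤q = subst (_≤ q - p) (ℚ.+-inverseʳ p) (ℚ.+-monoˡ-≤ (- p) p≤q)

  p<q⇒0<q-p : p < q → 0ℚ < q - p
  p<q⇒0<q-p p<q = subst (_< q - p) (ℚ.+-inverseʳ p) (ℚ.+-monoˡ-< (- p) p<q)

  0≤q-p⇒p≤q : 0ℚ ≤ q - p → p ≤ q
  0≤q-p⇒p≤q 0≤q-p = subst₂ _≤_ (ℚ.+-identityʳ p) (p+[q-p]≡q p q) (ℚ.+-monoʳ-≤ p 0≤q-p)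
    where
    open +-*-Solver
    p+[q-p]≡q : ∀ p q → p + (q - p) ≡ q
    p+[q-p]≡q = solve 2 (λ p q → p :+ (q :- p) := q) refl

  0<q-p⇒p<q : 0ℚ < q - p → p < q
  0<q-p⇒p<q 0<q-p = subst₂ _<_ (ℚ.+-identityʳ p) (p+[q-p]≡q p q) (ℚ.+-monoʳ-< p 0<q-p)
    where
    open +-*-Solver
    p+[q-p]≡q : ∀ p q → p + (q - p) ≡ q
    p+[q-p]≡q = solve 2 (λ p q → p :+ (q :- p) := q) refl

≤-decide : ∀ p q → {True (p ℚ.≤? q)} → p ≤ q
≤-decide p q {p≤q} = toWitness p≤q

<-decide : ∀ p q → {True (p ℚ.<? q)} → p < q
<-decide p q {p<q} = toWitness p<q

-- Signs in ℚ(√5)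

-- ε = (2 + √5)² is a unit with positive coordinates; multiplying x > 0 by a high power of ε moves it
-- towards the ray of √5, where both coordinates are positive.
ε : ℚ√5
ε = (+ 9 /ℚ 1) + (+ 4 /ℚ 1) √5

NonNegCoords : ℚ√5 → Set
NonNegCoords x = 0ℚ ≤ re x × 0ℚ ≤ im x

NonNeg : ℚ√5 → Set
NonNeg x = Σ ℕ λ k → NonNegCoords ((ε ^ k) ⊗ x)

PosCoords : ℚ√5 → Set
PosCoords x = 0ℚ < re x × 0ℚ < im x

Positive : ℚ√5 → Set
Positive x = Σ ℕ λ k → PosCoords ((ε ^ k) ⊗ x)

0≤five : 0ℚ ≤ five
0≤five = ≤-decide 0ℚ five

nonNegCoords-⊕ : ∀ {x y} → NonNegCoords x → NonNegCoords y → NonNegCoords (x ⊕ y)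
nonNegCoords-⊕ (0≤a , 0≤b) (0≤c , 0≤d) = nonNeg+nonNeg 0≤a 0≤c , nonNeg+nonNeg 0≤b 0≤d

nonNegCoords-⊗ : ∀ {x y} → NonNegCoords x → NonNegCoords y → NonNegCoords (x ⊗ y)
nonNegCoords-⊗ (0≤a , 0≤b) (0≤c , 0≤d) =
  nonNeg+nonNeg (nonNeg*nonNeg 0≤a 0≤c) (nonNeg*nonNeg 0≤five (nonNeg*nonNeg 0≤b 0≤d)) ,
  nonNeg+nonNeg (nonNeg*nonNeg 0≤a 0≤d) (nonNeg*nonNeg 0≤b 0≤c)

nonNegCoords-ε^ : ∀ k → NonNegCoords (ε ^ k)
nonNegCoords-ε^ zero    = ≤-decide 0ℚ 1ℚ , ℚ.≤-refl
nonNegCoords-ε^ (suc k) = nonNegCoords-⊗ (≤-decide 0ℚ (re ε) , ≤-decide 0ℚ (im ε)) (nonNegCoords-ε^ k)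

NonNeg-⊕ : ∀ {x y} → NonNeg x → NonNeg y → NonNeg (x ⊕ y)
NonNeg-⊕ {x} {y} (m , εᵐx≥0) (n , εⁿy≥0) = m ℕ.+ n , subst NonNegCoords (sym split)
  (nonNegCoords-⊕ (nonNegCoords-⊗ (nonNegCoords-ε^ n) εᵐx≥0) (nonNegCoords-⊗ (nonNegCoords-ε^ m) εⁿy≥0))
  where
  open ℚ√5-Solver
  rearrange : ∀ εᵐ εⁿ x y → (εᵐ ⊗ εⁿ) ⊗ (x ⊕ y) ≡ (εⁿ ⊗ (εᵐ ⊗ x)) ⊕ (εᵐ ⊗ (εⁿ ⊗ y))
  rearrange = solve 4 (λ εᵐ εⁿ x y → (εᵐ :* εⁿ) :* (x :+ y) := εⁿ :* (εᵐ :* x) :+ εᵐ :* (εⁿ :* y)) refl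
  split : (ε ^ (m ℕ.+ n)) ⊗ (x ⊕ y) ≡ ((ε ^ n) ⊗ ((ε ^ m) ⊗ x)) ⊕ ((ε ^ m) ⊗ ((ε ^ n) ⊗ y))
  split = trans (cong (_⊗ (x ⊕ y)) (^-+ ε m n)) (rearrange (ε ^ m) (ε ^ n) x y)

NonNeg-⊗ : ∀ {x y} → NonNeg x → NonNeg y → NonNeg (x ⊗ y)
NonNeg-⊗ {x} {y} (m , εᵐx≥0) (n , εⁿy≥0) = m ℕ.+ n , subst NonNegCoords (sym split) (nonNegCoords-⊗ εᵐx≥0 εⁿy≥0)
  where
  open ℚ√5-Solver
  rearrange : ∀ εᵐ εⁿ x y → (εᵐ ⊗ εⁿ) ⊗ (x ⊗ y) ≡ (εᵐ ⊗ x) ⊗ (εⁿ ⊗ y)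
  rearrange = solve 4 (λ εᵐ εⁿ x y → (εᵐ :* εⁿ) :* (x :* y) := (εᵐ :* x) :* (εⁿ :* y)) refl
  split : (ε ^ (m ℕ.+ n)) ⊗ (x ⊗ y) ≡ ((ε ^ m) ⊗ x) ⊗ ((ε ^ n) ⊗ y)
  split = trans (cong (_⊗ (x ⊗ y)) (^-+ ε m n)) (rearrange (ε ^ m) (ε ^ n) x y)

NonNeg-fromℚ : ∀ {q} → 0ℚ ≤ q → NonNeg (fromℚ q)
NonNeg-fromℚ {q} 0≤q = 0 , subst NonNegCoords (sym (⊗-identityˡ (fromℚ q))) (0≤q , ℚ.≤-refl)

NonNeg-decide : ∀ x k → {True (0ℚ ℚ.≤? re ((ε ^ k) ⊗ x))} → {True (0ℚ ℚ.≤? im ((ε ^ k) ⊗ x))} → NonNeg x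
NonNeg-decide x k {0≤re} {0≤im} = k , toWitness 0≤re , toWitness 0≤im

0<re-ε^ : ∀ k → 0ℚ < re (ε ^ k)
0<re-ε^ zero    = <-decide 0ℚ 1ℚ
0<re-ε^ (suc k) = pos+nonNeg (pos*pos (<-decide 0ℚ (re ε)) (0<re-ε^ k))
                             (nonNeg*nonNeg 0≤five (nonNeg*nonNeg (≤-decide 0ℚ (im ε)) (proj₂ (nonNegCoords-ε^ k))))

norm-ε^ : ∀ k → norm (ε ^ k) ≡ 1ℚ
norm-ε^ zero    = refl
norm-ε^ (suc k) = trans (norm-⊗ ε (ε ^ k)) (trans (cong (norm ε *_) (norm-ε^ k)) refl)

posCoords-ε⊗ : ∀ {z} → 0ℚ < re z → 0ℚ ≤ im z → PosCoords (ε ⊗ z)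
posCoords-ε⊗ 0<a 0≤b =
  pos+nonNeg (pos*pos (<-decide 0ℚ (re ε)) 0<a) (nonNeg*nonNeg 0≤five (nonNeg*nonNeg (≤-decide 0ℚ (im ε)) 0≤b)) ,
  nonNeg+pos (nonNeg*nonNeg (≤-decide 0ℚ (re ε)) 0≤b) (pos*pos (<-decide 0ℚ (im ε)) 0<a)

Positive-fromℚ-⊕ : ∀ {δ y} → 0ℚ < δ → NonNeg y → Positive (fromℚ δ ⊕ y)
Positive-fromℚ-⊕ {δ} {y} 0<δ (k , 0≤re , 0≤im) =
  suc k , subst PosCoords (sym (⊗-assoc ε (ε ^ k) (fromℚ δ ⊕ y))) (posCoords-ε⊗ 0<re-z 0≤im-z)
  where
  p = re (ε ^ k)
  q = im (ε ^ k)
  z = (ε ^ k) ⊗ (fromℚ δ ⊕ y)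
  open +-*-Solver
  re-expand : ∀ p q δ a b → p * (δ + a) + five * (q * (0ℚ + b)) ≡ p * δ + (p * a + five * (q * b))
  re-expand = solve 5 (λ p q δ a b → p :* (δ :+ a) :+ con five :* (q :* (con 0ℚ :+ b))
                                  := p :* δ :+ (p :* a :+ con five :* (q :* b))) refl
  im-expand : ∀ p q δ a b → p * (0ℚ + b) + q * (δ + a) ≡ q * δ + (p * b + q * a)
  im-expand = solve 5 (λ p q δ a b → p :* (con 0ℚ :+ b) :+ q :* (δ :+ a) := q :* δ :+ (p :* b :+ q :* a)) refl
  0<re-z : 0ℚ < re z
  0<re-z = subst (0ℚ <_) (sym (re-expand p q δ (re y) (im y))) (pos+nonNeg (pos*pos (0<re-ε^ k) 0<δ) 0≤re)
  0≤im-z : 0ℚ ≤ im z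
  0≤im-z = subst (0ℚ ≤_) (sym (im-expand p q δ (re y) (im y)))
             (nonNeg+nonNeg (nonNeg*nonNeg (proj₂ (nonNegCoords-ε^ k)) (ℚ.<⇒≤ 0<δ)) 0≤im)

square-nonNeg : ∀ b → 0ℚ ≤ b * b
square-nonNeg b with ℚ.≤-total 0ℚ b
... | inj₁ 0≤b = nonNeg*nonNeg 0≤b 0≤b
... | inj₂ b≤0 = subst (0ℚ ≤_) (neg*neg b) (nonNeg*nonNeg 0≤-b 0≤-b)
  where
  0≤-b : 0ℚ ≤ - b
  0≤-b = subst (0ℚ ≤_) (ℚ.+-identityˡ (- b)) (p≤q⇒0≤q-p b≤0)
  open +-*-Solver
  neg*neg : ∀ b → (- b) * (- b) ≡ b * b
  neg*neg = solve 1 (λ b → (:- b) :* (:- b) := b :* b) refl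

-- p + q√5 stands for a power of ε, and (p a + 5 q b, p b + q a) are the coordinates of its product with a + b√5.
module Signs {p q : ℚ} (0<p : 0ℚ < p) (0≤q : 0ℚ ≤ q) (p²-5q²≡1 : p * p - five * (q * q) ≡ 1ℚ) where

  private
    0≤2 : 0ℚ ≤ + 2 /ℚ 1
    0≤2 = ≤-decide 0ℚ (+ 2 /ℚ 1)

    0<-x : ∀ {x} → x < 0ℚ → 0ℚ < - x
    0<-x {x} x<0 = subst (0ℚ <_) (ℚ.+-identityˡ (- x)) (p<q⇒0<q-p x<0)

    0≤x²[p²-5q²] : ∀ x → 0ℚ ≤ (x * x) * (p * p - five * (q * q))
    0≤x²[p²-5q²] x = subst (0ℚ ≤_) (cong ((x * x) *_) (sym p²-5q²≡1))
                       (subst (0ℚ ≤_) (sym (ℚ.*-identityʳ (x * x))) (square-nonNeg x))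

  5b²<a²-if-neg-im : ∀ {a b} → 0ℚ < p * b + q * a → b < 0ℚ → five * (b * b) < a * a
  5b²<a²-if-neg-im {a} {b} 0<Y b<0 = 0<q-p⇒p<q (pos-cancelˡ (nonNeg*nonNeg 0≤q 0≤q) (subst (0ℚ <_) (sym (identity p q a b))
    (pos+nonNeg (pos*pos 0<Y (pos+nonNeg 0<Y (nonNeg*nonNeg 0≤2 (nonNeg*nonNeg (ℚ.<⇒≤ 0<p) (ℚ.<⇒≤ (0<-x b<0))))))
                (0≤x²[p²-5q²] b))))
    where
    open +-*-Solver
    identity : ∀ p q a b → (q * q) * (a * a - five * (b * b)) ≡
               (p * b + q * a) * ((p * b + q * a) + (+ 2 /ℚ 1) * (p * (- b))) + (b * b) * (p * p - five * (q * q))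
    identity = solve 4 (λ p q a b → (q :* q) :* (a :* a :- con five :* (b :* b)) :=
               (p :* b :+ q :* a) :* ((p :* b :+ q :* a) :+ con (+ 2 /ℚ 1) :* (p :* (:- b))) :+ (b :* b) :* (p :* p :- con five :* (q :* q))) refl

  a²<5b²-if-neg-re : ∀ {a b} → 0ℚ < p * a + five * (q * b) → a < 0ℚ → a * a < five * (b * b)
  a²<5b²-if-neg-re {a} {b} 0<X a<0 = 0<q-p⇒p<q (pos-cancelˡ (nonNeg*nonNeg 0≤five (nonNeg*nonNeg 0≤q 0≤q)) (subst (0ℚ <_) (sym (identity p q a b))
    (pos+nonNeg (pos*pos 0<X (pos+nonNeg 0<X (nonNeg*nonNeg 0≤2 (nonNeg*nonNeg (ℚ.<⇒≤ 0<p) (ℚ.<⇒≤ (0<-x a<0))))))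
                (0≤x²[p²-5q²] a))))
    where
    open +-*-Solver
    identity : ∀ p q a b → (five * (q * q)) * (five * (b * b) - a * a) ≡
               (p * a + five * (q * b)) * ((p * a + five * (q * b)) + (+ 2 /ℚ 1) * (p * (- a))) + (a * a) * (p * p - five * (q * q))
    identity = solve 4 (λ p q a b → (con five :* (q :* q)) :* (con five :* (b :* b) :- a :* a) :=
               (p :* a :+ con five :* (q :* b)) :* ((p :* a :+ con five :* (q :* b)) :+ con (+ 2 /ℚ 1) :* (p :* (:- a))) :+ (a :* a) :* (p :* p :- con five :* (q :* q))) refl

  0<a-if-neg-im : ∀ {a b} → 0ℚ < p * b + q * a → b < 0ℚ → 0ℚ < a
  0<a-if-neg-im {a} {b} 0<Y b<0 = pos-cancelˡ 0≤q (subst (0ℚ <_) (cancel p q a b) (pos+nonNeg 0<Y (nonNeg*nonNeg (ℚ.<⇒≤ 0<p) (ℚ.<⇒≤ (0<-x b<0)))))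
    where
    open +-*-Solver
    cancel : ∀ p q a b → (p * b + q * a) + p * (- b) ≡ q * a
    cancel = solve 4 (λ p q a b → (p :* b :+ q :* a) :+ p :* (:- b) := q :* a) refl

  0<a-if-zero-im : ∀ {a} → 0ℚ < p * a + five * (q * 0ℚ) → 0ℚ < a
  0<a-if-zero-im {a} 0<X = pos-cancelˡ (ℚ.<⇒≤ 0<p) (subst (0ℚ <_) (drop p q a) 0<X)
    where
    open +-*-Solver
    drop : ∀ p q a → p * a + five * (q * 0ℚ) ≡ p * a
    drop = solve 3 (λ p q a → p :* a :+ con five :* (q :* con 0ℚ) := p :* a) refl

Positive⇒Pos : ∀ x → Positive x → Pos x
Positive⇒Pos (a + b √5) (k , 0<X , 0<Y) = by-signs (ℚ.<-cmp b 0ℚ) (ℚ.<-cmp a 0ℚ)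
  where
  open Signs (0<re-ε^ k) (proj₂ (nonNegCoords-ε^ k)) (norm-ε^ k)
  by-signs : Tri (b < 0ℚ) (b ≡ 0ℚ) (0ℚ < b) → Tri (a < 0ℚ) (a ≡ 0ℚ) (0ℚ < a) → Pos (a + b √5)
  by-signs (tri< b<0 _ _) _              = inj₂ (inj₁ (0<a-if-neg-im 0<Y b<0 , b<0 , 5b²<a²-if-neg-im 0<Y b<0))
  by-signs (tri≈ _ b≡0 _) _              = inj₁ (ℚ.<⇒≤ 0<a , ℚ.≤-reflexive (sym b≡0) , inj₁ 0<a)
    where
    0<a = 0<a-if-zero-im (subst (λ b → 0ℚ < re (ε ^ k) * a + five * (im (ε ^ k) * b)) b≡0 0<X)
  by-signs (tri> _ _ 0<b) (tri< a<0 _ _) = inj₂ (inj₂ (a<0 , 0<b , a²<5b²-if-neg-re 0<X a<0))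
  by-signs (tri> _ _ 0<b) (tri≈ _ a≡0 _) = inj₁ (ℚ.≤-reflexive (sym a≡0) , ℚ.<⇒≤ 0<b , inj₂ 0<b)
  by-signs (tri> _ _ 0<b) (tri> _ _ 0<a) = inj₁ (ℚ.<⇒≤ 0<a , ℚ.<⇒≤ 0<b , inj₂ 0<b)

infix 4 ∣_∣≤_
record ∣_∣≤_ (x : ℚ√5) (A : ℚ) : Set where
  constructor _,_
  field
    lower : NonNeg (fromℚ A ⊖ x)
    upper : NonNeg (fromℚ A ⊕ x)

module _ where
  open ℚ√5-Solver

  bound-⊕ : ∀ {x y A B} → ∣ x ∣≤ A → ∣ y ∣≤ B → ∣ x ⊕ y ∣≤ A + B
  bound-⊕ {x} {y} {A} {B} (A-x≥0 , A+x≥0) (B-y≥0 , B+y≥0) =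
    subst NonNeg (sym (lower (fromℚ A) (fromℚ B) x y)) (NonNeg-⊕ A-x≥0 B-y≥0) ,
    subst NonNeg (sym (upper (fromℚ A) (fromℚ B) x y)) (NonNeg-⊕ A+x≥0 B+y≥0)
    where
    lower : ∀ A B x y → (A ⊕ B) ⊖ (x ⊕ y) ≡ (A ⊖ x) ⊕ (B ⊖ y)
    lower = solve 4 (λ A B x y → (A :+ B) :- (x :+ y) := (A :- x) :+ (B :- y)) refl
    upper : ∀ A B x y → (A ⊕ B) ⊕ (x ⊕ y) ≡ (A ⊕ x) ⊕ (B ⊕ y)
    upper = solve 4 (λ A B x y → (A :+ B) :+ (x :+ y) := (A :+ x) :+ (B :+ y)) refl

  bound-neg : ∀ {x A} → ∣ x ∣≤ A → ∣ ⊖ x ∣≤ A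
  bound-neg {x} {A} (A-x≥0 , A+x≥0) = subst NonNeg (lower (fromℚ A) x) A+x≥0 , A-x≥0
    where
    lower : ∀ A x → A ⊕ x ≡ A ⊖ (⊖ x)
    lower = solve 2 (λ A x → A :+ x := A :- (:- x)) refl

  bound-⊖ : ∀ {x y A B} → ∣ x ∣≤ A → ∣ y ∣≤ B → ∣ x ⊖ y ∣≤ A + B
  bound-⊖ ∣x∣≤A ∣y∣≤B = bound-⊕ ∣x∣≤A (bound-neg ∣y∣≤B)

  bound-mono : ∀ {x A B} → A ≤ B → ∣ x ∣≤ A → ∣ x ∣≤ B
  bound-mono {x} {A} {B} A≤B (A-x≥0 , A+x≥0) =
    subst NonNeg (sym (lower (fromℚ A) (fromℚ B) x)) (NonNeg-⊕ A-x≥0 B-A≥0) ,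
    subst NonNeg (sym (upper (fromℚ A) (fromℚ B) x)) (NonNeg-⊕ A+x≥0 B-A≥0)
    where
    B-A≥0 : NonNeg (fromℚ B ⊖ fromℚ A)
    B-A≥0 = NonNeg-fromℚ (p≤q⇒0≤q-p A≤B)
    lower : ∀ A B x → B ⊖ x ≡ (A ⊖ x) ⊕ (B ⊖ A)
    lower = solve 3 (λ A B x → B :- x := (A :- x) :+ (B :- A)) refl
    upper : ∀ A B x → B ⊕ x ≡ (A ⊕ x) ⊕ (B ⊖ A)
    upper = solve 3 (λ A B x → B :+ x := (A :+ x) :+ (B :- A)) refl

  bound-⊗ : ∀ {x y A B} → ∣ x ∣≤ A → ∣ y ∣≤ B → ∣ x ⊗ y ∣≤ A * B
  bound-⊗ {x} {y} {A} {B} (A-x≥0 , A+x≥0) (B-y≥0 , B+y≥0) =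
    subst NonNeg (sym (trans (cong (_⊖ (x ⊗ y)) (fromℚ-* A B)) (lower (fromℚ A) (fromℚ B) x y)))
      (NonNeg-⊗ ½≥0 (NonNeg-⊕ (NonNeg-⊗ A-x≥0 B+y≥0) (NonNeg-⊗ A+x≥0 B-y≥0))) ,
    subst NonNeg (sym (trans (cong (_⊕ (x ⊗ y)) (fromℚ-* A B)) (upper (fromℚ A) (fromℚ B) x y)))
      (NonNeg-⊗ ½≥0 (NonNeg-⊕ (NonNeg-⊗ A-x≥0 B-y≥0) (NonNeg-⊗ A+x≥0 B+y≥0)))
    where
    ½≥0 : NonNeg (fromℚ half)
    ½≥0 = NonNeg-fromℚ (≤-decide 0ℚ half)
    lower : ∀ A B x y → (A ⊗ B) ⊖ (x ⊗ y) ≡ fromℚ half ⊗ (((A ⊖ x) ⊗ (B ⊕ y)) ⊕ ((A ⊕ x) ⊗ (B ⊖ y)))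
    lower = solve 4 (λ A B x y → (A :* B) :- (x :* y) := con (fromℚ half) :* ((A :- x) :* (B :+ y) :+ (A :+ x) :* (B :- y))) refl
    upper : ∀ A B x y → (A ⊗ B) ⊕ (x ⊗ y) ≡ fromℚ half ⊗ (((A ⊖ x) ⊗ (B ⊖ y)) ⊕ ((A ⊕ x) ⊗ (B ⊕ y)))
    upper = solve 4 (λ A B x y → (A :* B) :+ (x :* y) := con (fromℚ half) :* ((A :- x) :* (B :- y) :+ (A :+ x) :* (B :+ y))) refl

bound-fromℚ : ∀ {q A} → 0ℚ ≤ A - q → 0ℚ ≤ A + q → ∣ fromℚ q ∣≤ A
bound-fromℚ 0≤A-q 0≤A+q = NonNeg-fromℚ 0≤A-q , NonNeg-fromℚ 0≤A+q

bound-decide : ∀ x A k → {True (0ℚ ℚ.≤? re ((ε ^ k) ⊗ (fromℚ A ⊖ x)))} → {True (0ℚ ℚ.≤? im ((ε ^ k) ⊗ (fromℚ A ⊖ x)))}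
                       → {True (0ℚ ℚ.≤? re ((ε ^ k) ⊗ (fromℚ A ⊕ x)))} → {True (0ℚ ℚ.≤? im ((ε ^ k) ⊗ (fromℚ A ⊕ x)))}
                       → ∣ x ∣≤ A
bound-decide x A k {p₁} {p₂} {p₃} {p₄} = NonNeg-decide (fromℚ A ⊖ x) k {p₁} {p₂} , NonNeg-decide (fromℚ A ⊕ x) k {p₃} {p₄}

bound⇒AbsLt : ∀ {x A δ} → ∣ x ∣≤ A → A < δ → AbsLt x δ
bound⇒AbsLt {x} {A} {δ} (A-x≥0 , A+x≥0) A<δ =
  Positive⇒Pos _ (subst Positive (sym (lower (fromℚ δ) (fromℚ A) x)) (Positive-fromℚ-⊕ 0<δ-A A-x≥0)) ,
  Positive⇒Pos _ (subst Positive (sym (upper (fromℚ δ) (fromℚ A) x)) (Positive-fromℚ-⊕ 0<δ-A A+x≥0))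
  where
  0<δ-A = p<q⇒0<q-p A<δ
  open ℚ√5-Solver
  lower : ∀ δ A x → δ ⊖ x ≡ (δ ⊖ A) ⊕ (A ⊖ x)
  lower = solve 3 (λ δ A x → δ :- x := (δ :- A) :+ (A :- x)) refl
  upper : ∀ δ A x → δ ⊕ x ≡ (δ ⊖ A) ⊕ (A ⊕ x)
  upper = solve 3 (λ δ A x → δ :+ x := (δ :- A) :+ (A :+ x)) refl

-- Geometric and Archimedean estimates in ℚ

^ℚ-nonNeg : ∀ {r} → 0ℚ ≤ r → ∀ n → 0ℚ ≤ r ^ℚ n
^ℚ-nonNeg 0≤r zero    = ≤-decide 0ℚ 1ℚ
^ℚ-nonNeg 0≤r (suc n) = nonNeg*nonNeg 0≤r (^ℚ-nonNeg 0≤r n)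

^ℚ-antitone : ∀ {r} → 0ℚ ≤ r → r ≤ 1ℚ → ∀ {m n} → m ℕ.≤ n → r ^ℚ n ≤ r ^ℚ m
^ℚ-antitone {r} 0≤r r≤1 {m} {n} m≤n with ℕ.m≤n⇒∃[o]m+o≡n m≤n
... | o , refl = subst (_≤ r ^ℚ m) (sym (trans (^ℚ-+ r m o) (ℚ.*-comm (r ^ℚ m) (r ^ℚ o))))
                   (subst (r ^ℚ o * r ^ℚ m ≤_) (ℚ.*-identityˡ (r ^ℚ m)) (ℚ.*-monoʳ-≤-nonNeg (r ^ℚ m) {{ℚ.nonNegative (^ℚ-nonNeg 0≤r m)}} (≤1 o)))
  where
  ≤1 : ∀ o → r ^ℚ o ≤ 1ℚ
  ≤1 zero    = ℚ.≤-refl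
  ≤1 (suc o) = ℚ.≤-trans (ℚ.*-monoˡ-≤-nonNeg r {{ℚ.nonNegative 0≤r}} (≤1 o)) (subst (_≤ 1ℚ) (sym (ℚ.*-identityʳ r)) r≤1)

bound-0q : ∀ {A} → 0ℚ ≤ A → ∣ 0q ∣≤ A
bound-0q {A} 0≤A = bound-fromℚ (subst (0ℚ ≤_) (sym (ℚ.+-identityʳ A)) 0≤A) (subst (0ℚ ≤_) (sym (ℚ.+-identityʳ A)) 0≤A)

bound-Σ-geometric : ∀ {r G C} m f → 0ℚ ≤ r → 0ℚ ≤ C → 0ℚ ≤ G → 1ℚ ≤ G * (1ℚ - r) →
                    (∀ i → i ℕ.< m → ∣ f i ∣≤ C * r ^ℚ i) → ∣ Σ< m f ∣≤ G * C
bound-Σ-geometric {r} {G} {C} m f 0≤r 0≤C 0≤G 1≤G[1-r] ∣fᵢ∣≤ =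
  bound-mono (0≤q-p⇒p≤q (subst (0ℚ ≤_) (sym (drop m)) (nonNeg*nonNeg 0≤G (nonNeg*nonNeg 0≤C (^ℚ-nonNeg 0≤r m))))) (partial m ∣fᵢ∣≤)
  where
  open +-*-Solver
  drop : ∀ m → G * C - (G * C - G * (C * r ^ℚ m)) ≡ G * (C * r ^ℚ m)
  drop m = solve 3 (λ G C x → G :* C :- (G :* C :- G :* (C :* x)) := G :* (C :* x)) refl G C (r ^ℚ m)
  step : ∀ x → (G * C - G * (C * (r * x))) - ((G * C - G * (C * x)) + C * x) ≡ (C * x) * (G * (1ℚ - r) - 1ℚ)
  step = solve 4 (λ G C r x → (G :* C :- G :* (C :* (r :* x))) :- ((G :* C :- G :* (C :* x)) :+ C :* x)
                           := (C :* x) :* (G :* (con 1ℚ :- r) :- con 1ℚ)) refl G C r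
  base : ∀ G C → G * C - G * (C * 1ℚ) ≡ 0ℚ
  base = solve 2 (λ G C → G :* C :- G :* (C :* con 1ℚ) := con 0ℚ) refl
  partial : ∀ m → (∀ i → i ℕ.< m → ∣ f i ∣≤ C * r ^ℚ i) → ∣ Σ< m f ∣≤ G * C - G * (C * r ^ℚ m)
  partial zero    _     = subst (∣ 0q ∣≤_) (sym (base G C)) (bound-0q ℚ.≤-refl)
  partial (suc m) ∣fᵢ∣≤ = bound-mono
    (0≤q-p⇒p≤q (subst (0ℚ ≤_) (sym (step (r ^ℚ m))) (nonNeg*nonNeg (nonNeg*nonNeg 0≤C (^ℚ-nonNeg 0≤r m)) (p≤q⇒0≤q-p 1≤G[1-r]))))
    (bound-⊕ (partial m (λ i i<m → ∣fᵢ∣≤ i (ℕ.m<n⇒m<1+n i<m))) (∣fᵢ∣≤ m (ℕ.n<1+n m)))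

ℕ→ℚ : ℕ → ℚ
ℕ→ℚ zero    = 0ℚ
ℕ→ℚ (suc n) = ℕ→ℚ n + 1ℚ

ℕ→ℚ-nonNeg : ∀ n → 0ℚ ≤ ℕ→ℚ n
ℕ→ℚ-nonNeg zero    = ℚ.≤-refl
ℕ→ℚ-nonNeg (suc n) = nonNeg+nonNeg (ℕ→ℚ-nonNeg n) (≤-decide 0ℚ 1ℚ)

ℕ→ℚ-+ : ∀ m n → ℕ→ℚ (m ℕ.+ n) ≡ ℕ→ℚ m + ℕ→ℚ n
ℕ→ℚ-+ zero    n = sym (ℚ.+-identityˡ (ℕ→ℚ n))
ℕ→ℚ-+ (suc m) n = trans (cong (_+ 1ℚ) (ℕ→ℚ-+ m n)) (swap (ℕ→ℚ m) (ℕ→ℚ n))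
  where
  open +-*-Solver
  swap : ∀ a b → (a + b) + 1ℚ ≡ (a + 1ℚ) + b
  swap = solve 2 (λ a b → (a :+ b) :+ con 1ℚ := (a :+ con 1ℚ) :+ b) refl

ℕ→ℚ-* : ∀ m n → ℕ→ℚ (m ℕ.* n) ≡ ℕ→ℚ m * ℕ→ℚ n
ℕ→ℚ-* zero    n = sym (ℚ.*-zeroˡ (ℕ→ℚ n))
ℕ→ℚ-* (suc m) n = trans (ℕ→ℚ-+ n (m ℕ.* n)) (trans (cong (λ z → ℕ→ℚ n + z) (ℕ→ℚ-* m n)) (expand (ℕ→ℚ m) (ℕ→ℚ n)))
  where
  open +-*-Solver
  expand : ∀ a b → b + a * b ≡ (a + 1ℚ) * b
  expand = solve 2 (λ a b → b :+ a :* b := (a :+ con 1ℚ) :* b) refl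

-- The rationals + n / d are built by normalisation, so facts about them go through the unnormalised ℚᵘ.
ℕ→ℚ≡/1 : ∀ n → ℕ→ℚ n ≡ + n /ℚ 1
ℕ→ℚ≡/1 zero    = refl
ℕ→ℚ≡/1 (suc n) = trans (cong (_+ 1ℚ) (ℕ→ℚ≡/1 n)) (ℚ.toℚᵘ-injective (begin
  ℚ.toℚᵘ (+ n /ℚ 1 + 1ℚ)                    ≈⟨ ℚ.toℚᵘ-homo-+ (+ n /ℚ 1) 1ℚ ⟩
  ℚ.toℚᵘ (+ n /ℚ 1) ℚᵘ.+ ℚ.toℚᵘ 1ℚ          ≈⟨ ℚᵘ.+-congˡ (ℚ.toℚᵘ 1ℚ) (ℚ.toℚᵘ-fromℚᵘ (mkℚᵘ (+ n) 0)) ⟩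
  mkℚᵘ (+ n) 0 ℚᵘ.+ mkℚᵘ (+ 1) 0            ≈⟨ *≡* (cong (ℤ._* + 1) (trans (cong (ℤ._+ + 1) (ℤ.*-identityʳ (+ n))) (cong +_ (ℕ.+-comm n 1)))) ⟩
  mkℚᵘ (+ suc n) 0                          ≈⟨ ℚᵘ.≃-sym (ℚ.toℚᵘ-fromℚᵘ (mkℚᵘ (+ suc n) 0)) ⟩
  ℚ.toℚᵘ (+ suc n /ℚ 1)                     ∎))
  where open ℚᵘ.≃-Reasoning

i≤+∣i∣ : ∀ i → i ℤ.≤ + ℤ.∣ i ∣
i≤+∣i∣ (+ m)    = ℤ.≤-refl
i≤+∣i∣ -[1+ m ] = ℤ.-≤+

archimedean : ∀ r → Σ ℕ λ n → r < ℕ→ℚ n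
archimedean r@(mkℚ n d _) = suc ℤ.∣ n ∣ , subst (r <_) (sym (ℕ→ℚ≡/1 (suc ℤ.∣ n ∣)))
  (ℚ.toℚᵘ-cancel-< (ℚᵘ.<-respʳ-≃ (ℚᵘ.≃-sym (ℚ.toℚᵘ-fromℚᵘ (mkℚᵘ (+ suc ℤ.∣ n ∣) 0))) (*<* n<[1+∣n∣][1+d])))
  where
  n<[1+∣n∣][1+d] : n ℤ.* + 1 ℤ.< + suc ℤ.∣ n ∣ ℤ.* + suc d
  n<[1+∣n∣][1+d] = ℤ.≤-<-trans (ℤ.≤-reflexive (ℤ.*-identityʳ n))
    (ℤ.≤-<-trans (i≤+∣i∣ n) (ℤ.+<+ (ℕ.<-≤-trans (ℕ.n<1+n ℤ.∣ n ∣) (ℕ.m≤m*n (suc ℤ.∣ n ∣) (suc d)))))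

1/[1+_] : ℕ → ℚ
1/[1+ n ] = + 1 /ℚ suc n

[1+n]*1/[1+n] : ∀ n → ℕ→ℚ (suc n) * 1/[1+ n ] ≡ 1ℚ
[1+n]*1/[1+n] n = trans (cong (_* 1/[1+ n ]) (ℕ→ℚ≡/1 (suc n))) (ℚ.toℚᵘ-injective (begin
  ℚ.toℚᵘ (+ suc n /ℚ 1 * 1/[1+ n ])                  ≈⟨ ℚ.toℚᵘ-homo-* (+ suc n /ℚ 1) 1/[1+ n ] ⟩
  ℚ.toℚᵘ (+ suc n /ℚ 1) ℚᵘ.* ℚ.toℚᵘ 1/[1+ n ]        ≈⟨ ℚᵘ.*-cong (ℚ.toℚᵘ-fromℚᵘ (mkℚᵘ (+ suc n) 0)) (ℚ.toℚᵘ-fromℚᵘ (mkℚᵘ (+ 1) n)) ⟩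
  mkℚᵘ (+ suc n) 0 ℚᵘ.* mkℚᵘ (+ 1) n                 ≈⟨ *≡* (trans (ℤ.*-identityʳ _) (trans (ℤ.*-identityʳ (+ suc n)) (sym (trans (ℤ.*-identityˡ _) (ℤ.*-identityˡ (+ suc n)))))) ⟩
  ℚ.toℚᵘ 1ℚ                                           ∎))
  where open ℚᵘ.≃-Reasoning

1/[1+n]-unique : ∀ n x → ℕ→ℚ (suc n) * x ≡ 1ℚ → x ≡ 1/[1+ n ]
1/[1+n]-unique n x [1+n]x≡1 = begin
  x                                  ≡⟨ sym (ℚ.*-identityʳ x) ⟩
  x * 1ℚ                             ≡⟨ cong (x *_) (sym ([1+n]*1/[1+n] n)) ⟩
  x * (ℕ→ℚ (suc n) * 1/[1+ n ])      ≡⟨ sym (ℚ.*-assoc x (ℕ→ℚ (suc n)) 1/[1+ n ]) ⟩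
  (x * ℕ→ℚ (suc n)) * 1/[1+ n ]      ≡⟨ cong (_* 1/[1+ n ]) (trans (ℚ.*-comm x (ℕ→ℚ (suc n))) [1+n]x≡1) ⟩
  1ℚ * 1/[1+ n ]                     ≡⟨ ℚ.*-identityˡ 1/[1+ n ] ⟩
  1/[1+ n ]                          ∎
  where open ≡-Reasoning

0≤1/[1+n] : ∀ n → 0ℚ ≤ 1/[1+ n ]
0≤1/[1+n] n = ℚ.toℚᵘ-cancel-≤ (ℚᵘ.≤-respʳ-≃ (ℚᵘ.≃-sym (ℚ.toℚᵘ-fromℚᵘ (mkℚᵘ (+ 1) n))) (ℚᵘ.*≤* (ℤ.+≤+ z≤n)))

1/[1+n]≤1 : ∀ n → 1/[1+ n ] ≤ 1ℚ
1/[1+n]≤1 n = ℚ.toℚᵘ-cancel-≤ (ℚᵘ.≤-respˡ-≃ (ℚᵘ.≃-sym (ℚ.toℚᵘ-fromℚᵘ (mkℚᵘ (+ 1) n))) (ℚᵘ.*≤* (ℤ.+≤+ (s≤s z≤n))))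

1/[1+n]-scale : ∀ e m M → e ℕ.* suc m ≡ suc M → 1/[1+ m ] ≡ ℕ→ℚ e * 1/[1+ M ]
1/[1+n]-scale e m M e[1+m]≡1+M = sym (1/[1+n]-unique m (ℕ→ℚ e * 1/[1+ M ]) (begin
  ℕ→ℚ (suc m) * (ℕ→ℚ e * 1/[1+ M ])     ≡⟨ sym (ℚ.*-assoc (ℕ→ℚ (suc m)) (ℕ→ℚ e) 1/[1+ M ]) ⟩
  (ℕ→ℚ (suc m) * ℕ→ℚ e) * 1/[1+ M ]     ≡⟨ cong (_* 1/[1+ M ]) (trans (ℚ.*-comm (ℕ→ℚ (suc m)) (ℕ→ℚ e)) (sym (ℕ→ℚ-* e (suc m)))) ⟩
  ℕ→ℚ (e ℕ.* suc m) * 1/[1+ M ]         ≡⟨ cong (λ k → ℕ→ℚ k * 1/[1+ M ]) e[1+m]≡1+M ⟩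
  ℕ→ℚ (suc M) * 1/[1+ M ]               ≡⟨ [1+n]*1/[1+n] M ⟩
  1ℚ                                    ∎))
  where open ≡-Reasoning

archimedean-* : ∀ r {s} → 0ℚ < s → Σ ℕ λ n → r < ℕ→ℚ n * s
archimedean-* r {s} 0<s = n , subst (_< ℕ→ℚ n * s) r/s*s≡r (ℚ.*-monoˡ-<-pos s {{ℚ.positive 0<s}} r/s<n)
  where
  instance _ = ℚ.>-nonZero 0<s
  n = proj₁ (archimedean (r * ℚ.1/ s))
  r/s<n = proj₂ (archimedean (r * ℚ.1/ s))
  r/s*s≡r : r * ℚ.1/ s * s ≡ r
  r/s*s≡r = trans (ℚ.*-assoc r (ℚ.1/ s) s) (trans (cong (r *_) (ℚ.*-inverseˡ s)) (ℚ.*-identityʳ r))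

bernoulli : ∀ {r} → 0ℚ ≤ r → r ≤ 1ℚ → ∀ k → r ^ℚ k * (1ℚ + ℕ→ℚ k * (1ℚ - r)) ≤ 1ℚ
bernoulli {r} 0≤r r≤1 zero    = ℚ.≤-reflexive (base r)
  where
  open +-*-Solver
  base : ∀ r → 1ℚ * (1ℚ + 0ℚ * (1ℚ - r)) ≡ 1ℚ
  base = solve 1 (λ r → con 1ℚ :* (con 1ℚ :+ con 0ℚ :* (con 1ℚ :- r)) := con 1ℚ) refl
bernoulli {r} 0≤r r≤1 (suc k) = 0≤q-p⇒p≤q (subst (0ℚ ≤_) (sym (identity r (r ^ℚ k) (ℕ→ℚ k)))
  (nonNeg+nonNeg (p≤q⇒0≤q-p (bernoulli 0≤r r≤1 k))
                 (nonNeg*nonNeg (nonNeg*nonNeg (^ℚ-nonNeg 0≤r k) (nonNeg*nonNeg 0≤1-r 0≤1-r)) (ℕ→ℚ-nonNeg (suc k)))))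
  where
  0≤1-r = p≤q⇒0≤q-p r≤1
  open +-*-Solver
  identity : ∀ r x n → 1ℚ - (r * x) * (1ℚ + (n + 1ℚ) * (1ℚ - r))
                     ≡ (1ℚ - x * (1ℚ + n * (1ℚ - r))) + (x * ((1ℚ - r) * (1ℚ - r))) * (n + 1ℚ)
  identity = solve 3 (λ r x n → con 1ℚ :- (r :* x) :* (con 1ℚ :+ (n :+ con 1ℚ) :* (con 1ℚ :- r))
                             := (con 1ℚ :- x :* (con 1ℚ :+ n :* (con 1ℚ :- r))) :+ (x :* ((con 1ℚ :- r) :* (con 1ℚ :- r))) :* (n :+ con 1ℚ)) refl

-- With t = k (1 - r), Bernoulli gives t C rᵏ ≤ C; choosing k with C < t δ forces C rᵏ < δ.
^ℚ-eventually-< : ∀ {r C δ} → 0ℚ ≤ r → r < 1ℚ → 0ℚ ≤ C → 0ℚ < δ → Σ ℕ λ k → C * r ^ℚ k < δ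
^ℚ-eventually-< {r} {C} {δ} 0≤r r<1 0≤C 0<δ = k , ℚ.*-cancelˡ-<-nonNeg t {{ℚ.nonNegative 0≤t}} (ℚ.≤-<-trans tCrᵏ≤C C<tδ)
  where
  arch = archimedean-* C (pos*pos (p<q⇒0<q-p r<1) 0<δ)
  k = proj₁ arch
  t = ℕ→ℚ k * (1ℚ - r)
  C<tδ : C < t * δ
  C<tδ = subst (C <_) (sym (ℚ.*-assoc (ℕ→ℚ k) (1ℚ - r) δ)) (proj₂ arch)
  0≤t : 0ℚ ≤ t
  0≤t = nonNeg*nonNeg (ℕ→ℚ-nonNeg k) (p≤q⇒0≤q-p (ℚ.<⇒≤ r<1))
  x = r ^ℚ k
  tCrᵏ≤C : t * (C * x) ≤ C
  tCrᵏ≤C = 0≤q-p⇒p≤q (subst (0ℚ ≤_) (sym (identity t C x))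
    (nonNeg+nonNeg (nonNeg*nonNeg 0≤C (p≤q⇒0≤q-p (bernoulli 0≤r (ℚ.<⇒≤ r<1) k))) (nonNeg*nonNeg 0≤C (^ℚ-nonNeg 0≤r k))))
    where
    open +-*-Solver
    identity : ∀ a C x → C - a * (C * x) ≡ C * (1ℚ - x * (1ℚ + a)) + C * x
    identity = solve 3 (λ a C x → C :- a :* (C :* x) := C :* (con 1ℚ :- x :* (con 1ℚ :+ a)) :+ C :* x) refl

Σ-cong : ∀ n {f g} → (∀ i → i ℕ.< n → f i ≡ g i) → Σ< n f ≡ Σ< n g
Σ-cong zero    f≗g = refl
Σ-cong (suc n) f≗g = cong₂ _⊕_ (Σ-cong n (λ i i<n → f≗g i (ℕ.m<n⇒m<1+n i<n))) (f≗g n (ℕ.n<1+n n))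

Σ-zero : ∀ n {f} → (∀ i → i ℕ.< n → f i ≡ 0q) → Σ< n f ≡ 0q
Σ-zero n f≗0 = trans (Σ-cong n f≗0) (Σ0 n)
  where
  Σ0 : ∀ n → Σ< n (λ _ → 0q) ≡ 0q
  Σ0 zero    = refl
  Σ0 (suc n) = trans (cong (_⊕ 0q) (Σ0 n)) refl

module _ where
  open ℚ√5-Solver

  Σ-⊕ : ∀ n f g → Σ< n (λ i → f i ⊕ g i) ≡ Σ< n f ⊕ Σ< n g
  Σ-⊕ zero    f g = refl
  Σ-⊕ (suc n) f g = trans (cong (_⊕ (f n ⊕ g n)) (Σ-⊕ n f g)) (interchange (Σ< n f) (Σ< n g) (f n) (g n))
    where
    interchange : ∀ a b c d → (a ⊕ b) ⊕ (c ⊕ d) ≡ (a ⊕ c) ⊕ (b ⊕ d)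
    interchange = solve 4 (λ a b c d → (a :+ b) :+ (c :+ d) := (a :+ c) :+ (b :+ d)) refl

  Σ-⊗ˡ : ∀ n c f → Σ< n (λ i → c ⊗ f i) ≡ c ⊗ Σ< n f
  Σ-⊗ˡ zero    c f = sym (⊗-zeroʳ c)
  Σ-⊗ˡ (suc n) c f = trans (cong (_⊕ (c ⊗ f n)) (Σ-⊗ˡ n c f)) (sym (⊗-distribˡ-⊕ c (Σ< n f) (f n)))

  Σ-+ : ∀ m n f → Σ< (m ℕ.+ n) f ≡ Σ< m f ⊕ Σ< n (λ j → f (m ℕ.+ j))
  Σ-+ m zero    f = trans (cong (λ l → Σ< l f) (ℕ.+-identityʳ m)) (sym (⊕-identityʳ (Σ< m f)))
  Σ-+ m (suc n) f = begin
    Σ< (m ℕ.+ suc n) f                                 ≡⟨ cong (λ l → Σ< l f) (ℕ.+-suc m n) ⟩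
    Σ< (m ℕ.+ n) f ⊕ f (m ℕ.+ n)                       ≡⟨ cong (_⊕ f (m ℕ.+ n)) (Σ-+ m n f) ⟩
    (Σ< m f ⊕ Σ< n (λ j → f (m ℕ.+ j))) ⊕ f (m ℕ.+ n)   ≡⟨ ⊕-assoc (Σ< m f) _ _ ⟩
    Σ< m f ⊕ Σ< (suc n) (λ j → f (m ℕ.+ j))             ∎
    where open ≡-Reasoning

  Σ-suc : ∀ n f → Σ< (suc n) f ≡ f 0 ⊕ Σ< n (λ j → f (suc j))
  Σ-suc n f = trans (Σ-+ 1 n f) (cong (_⊕ Σ< n (λ j → f (suc j))) (⊕-identityˡ (f 0)))

ℕ→ℚ√5 : ℕ → ℚ√5
ℕ→ℚ√5 n = fromℚ (ℕ→ℚ n)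

1/[1+n]⊗[1+n] : ∀ n → fromℚ 1/[1+ n ] ⊗ ℕ→ℚ√5 (suc n) ≡ 1q
1/[1+n]⊗[1+n] n = trans (sym (fromℚ-* 1/[1+ n ] (ℕ→ℚ (suc n))))
                        (cong fromℚ (trans (ℚ.*-comm 1/[1+ n ] (ℕ→ℚ (suc n))) ([1+n]*1/[1+n] n)))

-- Formal power series in t, as coefficient sequences.
Series : Set
Series = ℕ → ℚ√5

δ₀ : Series
δ₀ zero    = 1q
δ₀ (suc k) = 0q

shift : Series → Series
shift f zero    = 0q
shift f (suc k) = f k

⟨_t+_t²⟩·_ : ℚ√5 → ℚ√5 → Series → Series
(⟨ a t+ b t²⟩· f) k = (a ⊗ shift f k) ⊕ (b ⊗ shift (shift f) k)

-- The Euler operator t d/dt.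
θ : Series → Series
θ f k = ℕ→ℚ√5 k ⊗ f k

module _ where
  open ℚ√5-Solver

  ⟨⟩·-cong : ∀ a b {f g} → (∀ j → f j ≡ g j) → ∀ k → (⟨ a t+ b t²⟩· f) k ≡ (⟨ a t+ b t²⟩· g) k
  ⟨⟩·-cong a b f≗g zero          = refl
  ⟨⟩·-cong a b f≗g (suc zero)    = cong (λ z → (a ⊗ z) ⊕ (b ⊗ 0q)) (f≗g 0)
  ⟨⟩·-cong a b f≗g (suc (suc k)) = cong₂ (λ z w → (a ⊗ z) ⊕ (b ⊗ w)) (f≗g (suc k)) (f≗g k)

  ⟨⟩·-0 : ∀ a b k → (⟨ a t+ b t²⟩· (λ _ → 0q)) k ≡ 0q
  ⟨⟩·-0 a b zero          = vanish a b
    where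
    vanish : ∀ a b → (a ⊗ 0q) ⊕ (b ⊗ 0q) ≡ 0q
    vanish = solve 2 (λ a b → a :* con 0q :+ b :* con 0q := con 0q) refl
  ⟨⟩·-0 a b (suc zero)    = ⟨⟩·-0 a b zero
  ⟨⟩·-0 a b (suc (suc k)) = ⟨⟩·-0 a b zero

  ⟨⟩·-⊕ : ∀ a b f g k → (⟨ a t+ b t²⟩· (λ j → f j ⊕ g j)) k ≡ (⟨ a t+ b t²⟩· f) k ⊕ (⟨ a t+ b t²⟩· g) k
  ⟨⟩·-⊕ a b f g zero          = solve 2 (λ a b → a :* con 0q :+ b :* con 0q := (a :* con 0q :+ b :* con 0q) :+ (a :* con 0q :+ b :* con 0q)) refl a b
  ⟨⟩·-⊕ a b f g (suc zero)    = solve 4 (λ a b f₀ g₀ → a :* (f₀ :+ g₀) :+ b :* con 0q := (a :* f₀ :+ b :* con 0q) :+ (a :* g₀ :+ b :* con 0q)) refl a b (f 0) (g 0)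
  ⟨⟩·-⊕ a b f g (suc (suc k)) = solve 6 (λ a b f₁ g₁ f₀ g₀ → a :* (f₁ :+ g₁) :+ b :* (f₀ :+ g₀) := (a :* f₁ :+ b :* f₀) :+ (a :* g₁ :+ b :* g₀)) refl
                                  a b (f (suc k)) (g (suc k)) (f k) (g k)

  ⟨⟩·-⊖ : ∀ a b f g k → (⟨ a t+ b t²⟩· (λ j → f j ⊖ g j)) k ≡ (⟨ a t+ b t²⟩· f) k ⊖ (⟨ a t+ b t²⟩· g) k
  ⟨⟩·-⊖ a b f g zero          = solve 2 (λ a b → a :* con 0q :+ b :* con 0q := (a :* con 0q :+ b :* con 0q) :- (a :* con 0q :+ b :* con 0q)) refl a b
  ⟨⟩·-⊖ a b f g (suc zero)    = solve 4 (λ a b f₀ g₀ → a :* (f₀ :- g₀) :+ b :* con 0q := (a :* f₀ :+ b :* con 0q) :- (a :* g₀ :+ b :* con 0q)) refl a b (f 0) (g 0)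
  ⟨⟩·-⊖ a b f g (suc (suc k)) = solve 6 (λ a b f₁ g₁ f₀ g₀ → a :* (f₁ :- g₁) :+ b :* (f₀ :- g₀) := (a :* f₁ :+ b :* f₀) :- (a :* g₁ :+ b :* g₀)) refl
                                  a b (f (suc k)) (g (suc k)) (f k) (g k)

  ⟨⟩·-⊗ˡ : ∀ a b c f k → (⟨ a t+ b t²⟩· (λ j → c ⊗ f j)) k ≡ c ⊗ (⟨ a t+ b t²⟩· f) k
  ⟨⟩·-⊗ˡ a b c f zero          = solve 3 (λ a b c → a :* con 0q :+ b :* con 0q := c :* (a :* con 0q :+ b :* con 0q)) refl a b c
  ⟨⟩·-⊗ˡ a b c f (suc zero)    = solve 4 (λ a b c f₀ → a :* (c :* f₀) :+ b :* con 0q := c :* (a :* f₀ :+ b :* con 0q)) refl a b c (f 0)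
  ⟨⟩·-⊗ˡ a b c f (suc (suc k)) = solve 5 (λ a b c f₁ f₀ → a :* (c :* f₁) :+ b :* (c :* f₀) := c :* (a :* f₁ :+ b :* f₀)) refl a b c (f (suc k)) (f k)

  ⟨⟩·-comm : ∀ a b a′ b′ f k → (⟨ a t+ b t²⟩· (⟨ a′ t+ b′ t²⟩· f)) k ≡ (⟨ a′ t+ b′ t²⟩· (⟨ a t+ b t²⟩· f)) k
  ⟨⟩·-comm a b a′ b′ f zero = solve 4 (λ a b a′ b′ → a :* con 0q :+ b :* con 0q := a′ :* con 0q :+ b′ :* con 0q) refl a b a′ b′
  ⟨⟩·-comm a b a′ b′ f (suc zero) = solve 4 (λ a b a′ b′ → a :* (a′ :* con 0q :+ b′ :* con 0q) :+ b :* con 0q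
                                                        := a′ :* (a :* con 0q :+ b :* con 0q) :+ b′ :* con 0q) refl a b a′ b′
  ⟨⟩·-comm a b a′ b′ f (suc (suc zero)) = solve 5 (λ a b a′ b′ f₀ → a :* (a′ :* f₀ :+ b′ :* con 0q) :+ b :* (a′ :* con 0q :+ b′ :* con 0q)
                                                              := a′ :* (a :* f₀ :+ b :* con 0q) :+ b′ :* (a :* con 0q :+ b :* con 0q)) refl a b a′ b′ (f 0)
  ⟨⟩·-comm a b a′ b′ f (suc (suc (suc zero))) = solve 6 (λ a b a′ b′ f₁ f₀ → a :* (a′ :* f₁ :+ b′ :* f₀) :+ b :* (a′ :* f₀ :+ b′ :* con 0q)
                                                                    := a′ :* (a :* f₁ :+ b :* f₀) :+ b′ :* (a :* f₀ :+ b :* con 0q)) refl a b a′ b′ (f 1) (f 0)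
  ⟨⟩·-comm a b a′ b′ f (suc (suc (suc (suc k)))) = solve 7 (λ a b a′ b′ f₂ f₁ f₀ → a :* (a′ :* f₂ :+ b′ :* f₁) :+ b :* (a′ :* f₁ :+ b′ :* f₀)
                                                                       := a′ :* (a :* f₂ :+ b :* f₁) :+ b′ :* (a :* f₁ :+ b :* f₀)) refl
                                                     a b a′ b′ (f (suc (suc k))) (f (suc k)) (f k)

  -- Leibniz rule: t d/dt (a t + b t²) = a t + 2b t².
  θ-⟨⟩· : ∀ a b f k → θ (⟨ a t+ b t²⟩· f) k ≡ (⟨ a t+ (b ⊕ b) t²⟩· f) k ⊕ (⟨ a t+ b t²⟩· θ f) k
  θ-⟨⟩· a b f zero          = solve 2 (λ a b → con 0q :* (a :* con 0q :+ b :* con 0q)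
                                            := a :* con 0q :+ (b :+ b) :* con 0q :+ (a :* con 0q :+ b :* con 0q)) refl a b
  θ-⟨⟩· a b f (suc zero)    = solve 3 (λ a b f₀ → con 1q :* (a :* f₀ :+ b :* con 0q)
                                            := a :* f₀ :+ (b :+ b) :* con 0q :+ (a :* (con 0q :* f₀) :+ b :* con 0q)) refl a b (f 0)
  θ-⟨⟩· a b f (suc (suc k)) = solve 5 (λ a b f₁ f₀ n → ((n :+ con 1q) :+ con 1q) :* (a :* f₁ :+ b :* f₀)
                                                    := a :* f₁ :+ (b :+ b) :* f₀ :+ (a :* ((n :+ con 1q) :* f₁) :+ b :* (n :* f₀))) refl
                                a b (f (suc k)) (f k) (ℕ→ℚ√5 k)

  ⟨⟩·-low : ∀ a b N {f} → (∀ j → j ℕ.< N → f j ≡ 0q) → ∀ k → k ℕ.≤ N → (⟨ a t+ b t²⟩· f) k ≡ 0q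
  ⟨⟩·-low a b N f<N≡0 zero          k≤N         = ⟨⟩·-0 a b zero
  ⟨⟩·-low a b N f<N≡0 (suc zero)    (s≤s 0<N)   = trans (cong (λ z → (a ⊗ z) ⊕ (b ⊗ 0q)) (f<N≡0 0 (s≤s 0<N))) (⟨⟩·-0 a b zero)
  ⟨⟩·-low a b N f<N≡0 (suc (suc k)) 2+k≤N       =
    trans (cong₂ (λ z w → (a ⊗ z) ⊕ (b ⊗ w)) (f<N≡0 (suc k) 2+k≤N) (f<N≡0 k (ℕ.<-trans (ℕ.n<1+n k) 2+k≤N))) (⟨⟩·-0 a b zero)

  ⟨⟩·-high : ∀ a b D {f} → (∀ j → D ℕ.≤ j → f j ≡ 0q) → ∀ k → 2 ℕ.+ D ℕ.≤ k → (⟨ a t+ b t²⟩· f) k ≡ 0q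
  ⟨⟩·-high a b D f≥D≡0 (suc (suc k)) (s≤s (s≤s D≤k)) =
    trans (cong₂ (λ z w → (a ⊗ z) ⊕ (b ⊗ w)) (f≥D≡0 (suc k) (ℕ.m≤n⇒m≤1+n D≤k)) (f≥D≡0 k D≤k)) (⟨⟩·-0 a b zero)

  -- Evaluation at t = 1.
  Σ-⟨⟩· : ∀ a b f D → f D ≡ 0q → Σ< (2 ℕ.+ D) (⟨ a t+ b t²⟩· f) ≡ (a ⊕ b) ⊗ Σ< D f
  Σ-⟨⟩· a b f D fD≡0 = begin
    Σ< (2 ℕ.+ D) (⟨ a t+ b t²⟩· f)                                  ≡⟨ Σ-⊕ (2 ℕ.+ D) (λ k → a ⊗ shift f k) (λ k → b ⊗ shift (shift f) k) ⟩
    Σ< (2 ℕ.+ D) (λ k → a ⊗ shift f k) ⊕ Σ< (2 ℕ.+ D) (λ k → b ⊗ shift (shift f) k)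
                                                                     ≡⟨ cong₂ _⊕_ (Σ-⊗ˡ (2 ℕ.+ D) a (shift f)) (Σ-⊗ˡ (2 ℕ.+ D) b (shift (shift f))) ⟩
    (a ⊗ Σ< (2 ℕ.+ D) (shift f)) ⊕ (b ⊗ Σ< (2 ℕ.+ D) (shift (shift f)))
                                                                     ≡⟨ cong₂ (λ z w → (a ⊗ z) ⊕ (b ⊗ w)) (Σ-shift (suc D) f) (trans (Σ-shift (suc D) (shift f)) (Σ-shift D f)) ⟩
    (a ⊗ (Σ< D f ⊕ f D)) ⊕ (b ⊗ Σ< D f)                             ≡⟨ cong (λ z → (a ⊗ (Σ< D f ⊕ z)) ⊕ (b ⊗ Σ< D f)) fD≡0 ⟩
    (a ⊗ (Σ< D f ⊕ 0q)) ⊕ (b ⊗ Σ< D f)                              ≡⟨ collect a b (Σ< D f) ⟩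
    (a ⊕ b) ⊗ Σ< D f                                                ∎
    where
    open ≡-Reasoning
    Σ-shift : ∀ m f → Σ< (suc m) (shift f) ≡ Σ< m f
    Σ-shift zero    f = ⊕-identityˡ 0q
    Σ-shift (suc m) f = cong (_⊕ f m) (Σ-shift m f)
    collect : ∀ a b s → (a ⊗ (s ⊕ 0q)) ⊕ (b ⊗ s) ≡ (a ⊕ b) ⊗ s
    collect = solve 3 (λ a b s → a :* (s :+ con 0q) :+ b :* s := (a :+ b) :* s) refl

-- Truncated logarithms

logSeries : ℕ → ℚ√5 → ℚ√5
logSeries N y = Σ< N (λ i → fromℚ 1/[1+ i ] ⊗ (y ^ suc i))

-- 1 - x ⋆ y = (1 - x)(1 - y), so -log(1 - x ⋆ y) = -log(1 - x) - log(1 - y).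
_⋆_ : ℚ√5 → ℚ√5 → ℚ√5
x ⋆ y = (x ⊕ y) ⊖ (x ⊗ y)

-- With Q = s t + p t², where s = x + y and p = -xy, we have 1 - Q = (1 - x t)(1 - y t). Hence
-- the degree-k coefficient of  logQ N = Σ_{n ≤ N} Qⁿ/n  is (xᵏ + yᵏ)/k for k ≤ N, and evaluating at
-- t = 1 splits  logSeries N (x ⋆ y)  into  logSeries N x + logSeries N y  plus the coefficients of
-- logQ N in degrees N < k ≤ 2N.
module LogProduct (x y : ℚ√5) where

  s p : ℚ√5
  s = x ⊕ y
  p = ⊖ (x ⊗ y)

  Q^_ : ℕ → Series
  Q^ zero    = δ₀
  Q^ (suc n) = ⟨ s t+ p t²⟩· (Q^ n)

  logQ : ℕ → Series
  logQ N k = Σ< N (λ n → fromℚ 1/[1+ n ] ⊗ (Q^ suc n) k)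

  [1-Q]·_ : Series → Series
  ([1-Q]· f) k = f k ⊖ (⟨ s t+ p t²⟩· f) k

  tQ′ : Series → Series
  tQ′ = ⟨ s t+ (p ⊕ p) t²⟩·_

  open ℚ√5-Solver

  θ-Q^ : ∀ n k → θ (Q^ suc n) k ≡ ℕ→ℚ√5 (suc n) ⊗ tQ′ (Q^ n) k
  θ-Q^ zero    k = begin
    θ (⟨ s t+ p t²⟩· δ₀) k                             ≡⟨ θ-⟨⟩· s p δ₀ k ⟩
    tQ′ δ₀ k ⊕ (⟨ s t+ p t²⟩· θ δ₀) k                   ≡⟨ cong (tQ′ δ₀ k ⊕_) (trans (⟨⟩·-cong s p θδ₀≡0 k) (⟨⟩·-0 s p k)) ⟩
    tQ′ δ₀ k ⊕ 0q                                      ≡⟨ trans (⊕-identityʳ (tQ′ δ₀ k)) (sym (⊗-identityˡ (tQ′ δ₀ k))) ⟩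
    1q ⊗ tQ′ δ₀ k                                      ∎
    where
    open ≡-Reasoning
    θδ₀≡0 : ∀ k → θ δ₀ k ≡ 0q
    θδ₀≡0 zero    = refl
    θδ₀≡0 (suc k) = ⊗-zeroʳ (ℕ→ℚ√5 (suc k))
  θ-Q^ (suc n) k = begin
    θ (⟨ s t+ p t²⟩· (Q^ suc n)) k                                       ≡⟨ θ-⟨⟩· s p (Q^ suc n) k ⟩
    tQ′ (Q^ suc n) k ⊕ (⟨ s t+ p t²⟩· θ (Q^ suc n)) k                    ≡⟨ cong (tQ′ (Q^ suc n) k ⊕_) (⟨⟩·-cong s p (θ-Q^ n) k) ⟩
    tQ′ (Q^ suc n) k ⊕ (⟨ s t+ p t²⟩· (λ j → ℕ→ℚ√5 (suc n) ⊗ tQ′ (Q^ n) j)) k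
                                                                         ≡⟨ cong (tQ′ (Q^ suc n) k ⊕_) (⟨⟩·-⊗ˡ s p (ℕ→ℚ√5 (suc n)) (tQ′ (Q^ n)) k) ⟩
    tQ′ (Q^ suc n) k ⊕ (ℕ→ℚ√5 (suc n) ⊗ (⟨ s t+ p t²⟩· tQ′ (Q^ n)) k)   ≡⟨ cong (λ z → tQ′ (Q^ suc n) k ⊕ (ℕ→ℚ√5 (suc n) ⊗ z)) (⟨⟩·-comm s p s (p ⊕ p) (Q^ n) k) ⟩
    tQ′ (Q^ suc n) k ⊕ (ℕ→ℚ√5 (suc n) ⊗ tQ′ (Q^ suc n) k)              ≡⟨ collect (tQ′ (Q^ suc n) k) (ℕ→ℚ√5 (suc n)) ⟩
    ℕ→ℚ√5 (suc (suc n)) ⊗ tQ′ (Q^ suc n) k                              ∎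
    where
    open ≡-Reasoning
    collect : ∀ m c → m ⊕ (c ⊗ m) ≡ (c ⊕ 1q) ⊗ m
    collect = solve 2 (λ m c → m :+ c :* m := (c :+ con 1q) :* m) refl

  Q^-low : ∀ n k → k ℕ.< n → (Q^ n) k ≡ 0q
  Q^-low (suc n) k (s≤s k≤n) = ⟨⟩·-low s p n (Q^-low n) k k≤n

  Q^-high : ∀ n k → 2 ℕ.* n ℕ.< k → (Q^ n) k ≡ 0q
  Q^-high zero    (suc k) _       = refl
  Q^-high (suc n) k       2+2n<k  = ⟨⟩·-high s p (suc (2 ℕ.* n)) (Q^-high n) k
    (subst (ℕ._≤ k) (cong suc (ℕ.*-suc 2 n)) 2+2n<k)

  Σ-Q^ : ∀ n D → 2 ℕ.* n ℕ.< D → Σ< D (Q^ n) ≡ (x ⋆ y) ^ n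
  Σ-Q^ n D 2n<D with ℕ.m≤n⇒∃[o]m+o≡n 2n<D
  ... | o , refl = trans (Σ-+ (suc (2 ℕ.* n)) o (Q^ n)) (trans (cong (Σ< (suc (2 ℕ.* n)) (Q^ n) ⊕_) tail≡0)
                     (trans (⊕-identityʳ _) (exact n)))
    where
    tail≡0 : Σ< o (λ j → (Q^ n) (suc (2 ℕ.* n) ℕ.+ j)) ≡ 0q
    tail≡0 = Σ-zero o (λ j _ → Q^-high n (suc (2 ℕ.* n) ℕ.+ j) (s≤s (ℕ.m≤m+n (2 ℕ.* n) j)))
    exact : ∀ n → Σ< (suc (2 ℕ.* n)) (Q^ n) ≡ (x ⋆ y) ^ n
    exact zero    = ⊕-identityˡ 1q
    exact (suc n) = begin
      Σ< (suc (2 ℕ.* suc n)) (Q^ suc n)           ≡⟨ cong (λ l → Σ< (suc l) (Q^ suc n)) (ℕ.*-suc 2 n) ⟩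
      Σ< (2 ℕ.+ suc (2 ℕ.* n)) (Q^ suc n)          ≡⟨ Σ-⟨⟩· s p (Q^ n) (suc (2 ℕ.* n)) (Q^-high n _ ℕ.≤-refl) ⟩
      (x ⋆ y) ⊗ Σ< (suc (2 ℕ.* n)) (Q^ n)          ≡⟨ cong ((x ⋆ y) ⊗_) (exact n) ⟩
      (x ⋆ y) ⊗ ((x ⋆ y) ^ n)                      ∎
      where open ≡-Reasoning

  Σ-logQ : ∀ N D → 2 ℕ.* N ℕ.< D → Σ< D (logQ N) ≡ logSeries N (x ⋆ y)
  Σ-logQ zero    D _      = Σ-zero D (λ _ _ → refl)
  Σ-logQ (suc N) D 2N+2<D = begin
    Σ< D (λ k → logQ N k ⊕ (fromℚ 1/[1+ N ] ⊗ (Q^ suc N) k))     ≡⟨ Σ-⊕ D (logQ N) (λ k → fromℚ 1/[1+ N ] ⊗ (Q^ suc N) k) ⟩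
    Σ< D (logQ N) ⊕ Σ< D (λ k → fromℚ 1/[1+ N ] ⊗ (Q^ suc N) k)  ≡⟨ cong₂ _⊕_ (Σ-logQ N D 2N<D) (Σ-⊗ˡ D (fromℚ 1/[1+ N ]) (Q^ suc N)) ⟩
    logSeries N (x ⋆ y) ⊕ (fromℚ 1/[1+ N ] ⊗ Σ< D (Q^ suc N))    ≡⟨ cong (λ z → logSeries N (x ⋆ y) ⊕ (fromℚ 1/[1+ N ] ⊗ z)) (Σ-Q^ (suc N) D 2N+2<D) ⟩
    logSeries (suc N) (x ⋆ y)                                    ∎
    where
    open ≡-Reasoning
    2N<D : 2 ℕ.* N ℕ.< D
    2N<D = ℕ.<-trans (ℕ.*-monoʳ-< 2 (ℕ.n<1+n N)) 2N+2<D

  [1-Q]·-⊖ : ∀ f g k → ([1-Q]· (λ j → f j ⊖ g j)) k ≡ ([1-Q]· f) k ⊖ ([1-Q]· g) k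
  [1-Q]·-⊖ f g k = trans (cong (λ z → (f k ⊖ g k) ⊖ z) (⟨⟩·-⊖ s p f g k))
    (solve 4 (λ a b c d → (a :- b) :- (c :- d) := (a :- c) :- (b :- d)) refl (f k) (g k) ((⟨ s t+ p t²⟩· f) k) ((⟨ s t+ p t²⟩· g) k))

  -- t d/dt (Qⁿ⁺¹/(n + 1)) = Qⁿ tQ′, and (1 - Q) Σ_{n < N} Qⁿ telescopes to 1 - Qᴺ.
  [1-Q]·θlogQ : ∀ N k → ([1-Q]· θ (logQ N)) k ≡ tQ′ δ₀ k ⊖ tQ′ (Q^ N) k
  [1-Q]·θlogQ zero    k = begin
    (ℕ→ℚ√5 k ⊗ 0q) ⊖ (⟨ s t+ p t²⟩· θ (logQ zero)) k    ≡⟨ cong (λ z → (ℕ→ℚ√5 k ⊗ 0q) ⊖ z) (trans (⟨⟩·-cong s p (λ j → ⊗-zeroʳ (ℕ→ℚ√5 j)) k) (⟨⟩·-0 s p k)) ⟩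
    (ℕ→ℚ√5 k ⊗ 0q) ⊖ 0q                                ≡⟨ solve 2 (λ n m → n :* con 0q :- con 0q := m :- m) refl (ℕ→ℚ√5 k) (tQ′ δ₀ k) ⟩
    tQ′ δ₀ k ⊖ tQ′ δ₀ k                                ∎
    where open ≡-Reasoning
  [1-Q]·θlogQ (suc N) k = begin
    ([1-Q]· θ (logQ (suc N))) k                                           ≡⟨ cong₂ _⊖_ (θlogQ-suc k) (⟨⟩·-cong s p θlogQ-suc k) ⟩
    (θ (logQ N) k ⊕ T k) ⊖ (⟨ s t+ p t²⟩· (λ j → θ (logQ N) j ⊕ T j)) k   ≡⟨ cong (λ z → (θ (logQ N) k ⊕ T k) ⊖ z) (⟨⟩·-⊕ s p (θ (logQ N)) T k) ⟩
    (θ (logQ N) k ⊕ T k) ⊖ ((⟨ s t+ p t²⟩· θ (logQ N)) k ⊕ (⟨ s t+ p t²⟩· T) k)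
                                                                          ≡⟨ regroup (θ (logQ N) k) (T k) ((⟨ s t+ p t²⟩· θ (logQ N)) k) ((⟨ s t+ p t²⟩· T) k) ⟩
    ([1-Q]· θ (logQ N)) k ⊕ (T k ⊖ (⟨ s t+ p t²⟩· T) k)                  ≡⟨ cong₂ (λ z w → z ⊕ (T k ⊖ w)) ([1-Q]·θlogQ N k) (⟨⟩·-comm s p s (p ⊕ p) (Q^ N) k) ⟩
    (tQ′ δ₀ k ⊖ T k) ⊕ (T k ⊖ tQ′ (Q^ suc N) k)                         ≡⟨ telescope (tQ′ δ₀ k) (T k) (tQ′ (Q^ suc N) k) ⟩
    tQ′ δ₀ k ⊖ tQ′ (Q^ suc N) k                                          ∎
    where
    open ≡-Reasoning
    T = tQ′ (Q^ N)
    distribute : ∀ n l i q → n ⊗ (l ⊕ (i ⊗ q)) ≡ (n ⊗ l) ⊕ (i ⊗ (n ⊗ q))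
    distribute = solve 4 (λ n l i q → n :* (l :+ i :* q) := n :* l :+ i :* (n :* q)) refl
    θlogQ-suc : ∀ j → θ (logQ (suc N)) j ≡ θ (logQ N) j ⊕ T j
    θlogQ-suc j = begin
      ℕ→ℚ√5 j ⊗ (logQ N j ⊕ (fromℚ 1/[1+ N ] ⊗ (Q^ suc N) j))    ≡⟨ distribute (ℕ→ℚ√5 j) (logQ N j) (fromℚ 1/[1+ N ]) ((Q^ suc N) j) ⟩
      θ (logQ N) j ⊕ (fromℚ 1/[1+ N ] ⊗ θ (Q^ suc N) j)           ≡⟨ cong (λ z → θ (logQ N) j ⊕ (fromℚ 1/[1+ N ] ⊗ z)) (θ-Q^ N j) ⟩
      θ (logQ N) j ⊕ (fromℚ 1/[1+ N ] ⊗ (ℕ→ℚ√5 (suc N) ⊗ T j))   ≡⟨ cong (θ (logQ N) j ⊕_) (sym (⊗-assoc (fromℚ 1/[1+ N ]) (ℕ→ℚ√5 (suc N)) (T j))) ⟩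
      θ (logQ N) j ⊕ ((fromℚ 1/[1+ N ] ⊗ ℕ→ℚ√5 (suc N)) ⊗ T j)   ≡⟨ cong (λ z → θ (logQ N) j ⊕ (z ⊗ T j)) (1/[1+n]⊗[1+n] N) ⟩
      θ (logQ N) j ⊕ (1q ⊗ T j)                                   ≡⟨ cong (θ (logQ N) j ⊕_) (⊗-identityˡ (T j)) ⟩
      θ (logQ N) j ⊕ T j                                          ∎
    regroup : ∀ a b c d → (a ⊕ b) ⊖ (c ⊕ d) ≡ (a ⊖ c) ⊕ (b ⊖ d)
    regroup = solve 4 (λ a b c d → (a :+ b) :- (c :+ d) := (a :- c) :+ (b :- d)) refl
    telescope : ∀ a b c → (a ⊖ b) ⊕ (b ⊖ c) ≡ a ⊖ c
    telescope = solve 3 (λ a b c → (a :- b) :+ (b :- c) := a :- c) refl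

  powerSum : Series
  powerSum zero    = 0q
  powerSum (suc k) = (x ^ suc k) ⊕ (y ^ suc k)

  -- Newton's identities for the power sums of the roots x, y of  T² - s T - p.
  [1-Q]·powerSum : ∀ k → ([1-Q]· powerSum) k ≡ tQ′ δ₀ k
  [1-Q]·powerSum zero                = solve 2 (λ s p → con 0q :- (s :* con 0q :+ p :* con 0q) := s :* con 0q :+ (p :+ p) :* con 0q) refl s p
  [1-Q]·powerSum (suc zero)          = solve 2 (λ x y → (x :* con 1q :+ y :* con 1q) :- ((x :+ y) :* con 0q :+ (:- (x :* y)) :* con 0q)
                                                    := (x :+ y) :* con 1q :+ ((:- (x :* y)) :+ (:- (x :* y))) :* con 0q) refl x y
  [1-Q]·powerSum (suc (suc zero))    = solve 2 (λ x y → (x :* (x :* con 1q) :+ y :* (y :* con 1q)) :- ((x :+ y) :* (x :* con 1q :+ y :* con 1q) :+ (:- (x :* y)) :* con 0q)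
                                                    := (x :+ y) :* con 0q :+ ((:- (x :* y)) :+ (:- (x :* y))) :* con 1q) refl x y
  [1-Q]·powerSum (suc (suc (suc k))) = solve 4 (λ x y xᵏ yᵏ → (x :* (x :* (x :* xᵏ)) :+ y :* (y :* (y :* yᵏ)))
                                                         :- ((x :+ y) :* (x :* (x :* xᵏ) :+ y :* (y :* yᵏ)) :+ (:- (x :* y)) :* (x :* xᵏ :+ y :* yᵏ))
                                                    := (x :+ y) :* con 0q :+ ((:- (x :* y)) :+ (:- (x :* y))) :* con 0q) refl x y (x ^ k) (y ^ k)

  -- 1 - Q has constant term 1, so multiplication by it is triangular.
  [1-Q]·-injective : ∀ N g → (∀ k → k ℕ.≤ N → ([1-Q]· g) k ≡ 0q) → ∀ k → k ℕ.≤ N → g k ≡ 0q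
  [1-Q]·-injective N g [1-Q]g≡0 k k≤N = below (suc k) (s≤s k≤N) k (ℕ.n<1+n k)
    where
    below : ∀ m → m ℕ.≤ suc N → ∀ j → j ℕ.< m → g j ≡ 0q
    below (suc m) (s≤s m≤N) j j<1+m with ℕ.m<1+n⇒m<n∨m≡n j<1+m
    ... | inj₁ j<m  = below m (ℕ.m≤n⇒m≤1+n m≤N) j j<m
    ... | inj₂ refl = begin
      g j                                                    ≡⟨ solve 2 (λ a b → a := (a :- b) :+ b) refl (g j) ((⟨ s t+ p t²⟩· g) j) ⟩
      ([1-Q]· g) j ⊕ (⟨ s t+ p t²⟩· g) j                     ≡⟨ cong₂ _⊕_ ([1-Q]g≡0 j m≤N) (⟨⟩·-low s p j (below m (ℕ.m≤n⇒m≤1+n m≤N)) j ℕ.≤-refl) ⟩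
      0q ⊕ 0q                                                ≡⟨ ⊕-identityˡ 0q ⟩
      0q                                                     ∎
      where open ≡-Reasoning

  θlogQ≡powerSum : ∀ N k → k ℕ.≤ N → θ (logQ N) k ≡ powerSum k
  θlogQ≡powerSum N k k≤N = trans (solve 2 (λ a b → a := (a :- b) :+ b) refl (θ (logQ N) k) (powerSum k))
    (trans (cong (_⊕ powerSum k) ([1-Q]·-injective N (λ j → θ (logQ N) j ⊖ powerSum j) vanishes k k≤N)) (⊕-identityˡ (powerSum k)))
    where
    vanishes : ∀ j → j ℕ.≤ N → ([1-Q]· (λ i → θ (logQ N) i ⊖ powerSum i)) j ≡ 0q
    vanishes j j≤N = begin
      ([1-Q]· (λ i → θ (logQ N) i ⊖ powerSum i)) j           ≡⟨ [1-Q]·-⊖ (θ (logQ N)) powerSum j ⟩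
      ([1-Q]· θ (logQ N)) j ⊖ ([1-Q]· powerSum) j            ≡⟨ cong₂ _⊖_ ([1-Q]·θlogQ N j) ([1-Q]·powerSum j) ⟩
      (tQ′ δ₀ j ⊖ tQ′ (Q^ N) j) ⊖ tQ′ δ₀ j                   ≡⟨ cong (λ z → (tQ′ δ₀ j ⊖ z) ⊖ tQ′ δ₀ j) (⟨⟩·-low s (p ⊕ p) N (Q^-low N) j j≤N) ⟩
      (tQ′ δ₀ j ⊖ 0q) ⊖ tQ′ δ₀ j                             ≡⟨ solve 1 (λ a → (a :- con 0q) :- a := con 0q) refl (tQ′ δ₀ j) ⟩
      0q                                                     ∎
      where open ≡-Reasoning

  logQ-0 : ∀ N → logQ N 0 ≡ 0q
  logQ-0 N = Σ-zero N (λ n _ → trans (cong (fromℚ 1/[1+ n ] ⊗_) (Q^-low (suc n) 0 (s≤s z≤n))) (⊗-zeroʳ (fromℚ 1/[1+ n ])))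

  logQ-suc : ∀ N k → suc k ℕ.≤ N → logQ N (suc k) ≡ fromℚ 1/[1+ k ] ⊗ powerSum (suc k)
  logQ-suc N k k<N = begin
    logQ N (suc k)                                              ≡⟨ sym (⊗-identityˡ (logQ N (suc k))) ⟩
    1q ⊗ logQ N (suc k)                                         ≡⟨ cong (_⊗ logQ N (suc k)) (sym (1/[1+n]⊗[1+n] k)) ⟩
    (fromℚ 1/[1+ k ] ⊗ ℕ→ℚ√5 (suc k)) ⊗ logQ N (suc k)         ≡⟨ ⊗-assoc (fromℚ 1/[1+ k ]) (ℕ→ℚ√5 (suc k)) (logQ N (suc k)) ⟩
    fromℚ 1/[1+ k ] ⊗ θ (logQ N) (suc k)                        ≡⟨ cong (fromℚ 1/[1+ k ] ⊗_) (θlogQ≡powerSum N (suc k) k<N) ⟩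
    fromℚ 1/[1+ k ] ⊗ powerSum (suc k)                          ∎
    where open ≡-Reasoning

  logSeries-⋆ : ∀ N → logSeries N (x ⋆ y) ≡ (logSeries N x ⊕ logSeries N y) ⊕ Σ< N (λ j → logQ N (suc N ℕ.+ j))
  logSeries-⋆ N = begin
    logSeries N (x ⋆ y)                                              ≡⟨ sym (Σ-logQ N (suc N ℕ.+ N) (s≤s (ℕ.≤-reflexive (cong (N ℕ.+_) (ℕ.+-identityʳ N))))) ⟩
    Σ< (suc N ℕ.+ N) (logQ N)                                        ≡⟨ Σ-+ (suc N) N (logQ N) ⟩
    Σ< (suc N) (logQ N) ⊕ tail                                       ≡⟨ cong (_⊕ tail) (Σ-suc N (logQ N)) ⟩
    (logQ N 0 ⊕ Σ< N (λ k → logQ N (suc k))) ⊕ tail                  ≡⟨ cong (λ z → (z ⊕ Σ< N (λ k → logQ N (suc k))) ⊕ tail) (logQ-0 N) ⟩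
    (0q ⊕ Σ< N (λ k → logQ N (suc k))) ⊕ tail                        ≡⟨ cong (_⊕ tail) (⊕-identityˡ (Σ< N (λ k → logQ N (suc k)))) ⟩
    Σ< N (λ k → logQ N (suc k)) ⊕ tail                               ≡⟨ cong (_⊕ tail) (Σ-cong N (λ k k<N → logQ-suc N k k<N)) ⟩
    Σ< N (λ k → fromℚ 1/[1+ k ] ⊗ powerSum (suc k)) ⊕ tail           ≡⟨ cong (_⊕ tail) (trans (Σ-cong N (λ k _ → ⊗-distribˡ-⊕ (fromℚ 1/[1+ k ]) (x ^ suc k) (y ^ suc k)))
                                                                          (Σ-⊕ N (λ k → fromℚ 1/[1+ k ] ⊗ (x ^ suc k)) (λ k → fromℚ 1/[1+ k ] ⊗ (y ^ suc k)))) ⟩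
    (logSeries N x ⊕ logSeries N y) ⊕ tail                           ∎
    where
    open ≡-Reasoning
    tail = Σ< N (λ j → logQ N (suc N ℕ.+ j))

bound-1/[1+n] : ∀ n → ∣ fromℚ 1/[1+ n ] ∣≤ 1ℚ
bound-1/[1+n] n = bound-fromℚ (p≤q⇒0≤q-p (1/[1+n]≤1 n)) (nonNeg+nonNeg (≤-decide 0ℚ 1ℚ) (0≤1/[1+n] n))

bound-1/[1+n]⊗ : ∀ n {z A} → ∣ z ∣≤ A → ∣ fromℚ 1/[1+ n ] ⊗ z ∣≤ A
bound-1/[1+n]⊗ n {z} {A} ∣z∣≤A = subst (∣ fromℚ 1/[1+ n ] ⊗ z ∣≤_) (ℚ.*-identityˡ A) (bound-⊗ (bound-1/[1+n] n) ∣z∣≤A)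

bound-^ : ∀ {y Y} → ∣ y ∣≤ Y → ∀ k → ∣ y ^ k ∣≤ Y ^ℚ k
bound-^ ∣y∣≤Y zero    = bound-fromℚ (≤-decide 0ℚ (1ℚ - 1ℚ)) (≤-decide 0ℚ (1ℚ + 1ℚ))
bound-^ ∣y∣≤Y (suc k) = bound-⊗ ∣y∣≤Y (bound-^ ∣y∣≤Y k)

bound-logSeries-tail : ∀ {y Y G} n m → ∣ y ∣≤ Y → 0ℚ ≤ Y → 0ℚ ≤ G → 1ℚ ≤ G * (1ℚ - Y) →
                       ∣ logSeries (n ℕ.+ m) y ⊖ logSeries n y ∣≤ G * Y ^ℚ suc n
bound-logSeries-tail {y} {Y} {G} n m ∣y∣≤Y 0≤Y 0≤G 1≤G[1-Y] = subst (∣_∣≤ G * Y ^ℚ suc n) (sym difference≡tail)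
  (bound-Σ-geometric m _ 0≤Y (^ℚ-nonNeg 0≤Y (suc n)) 0≤G 1≤G[1-Y]
    (λ j _ → subst (∣ fromℚ 1/[1+ n ℕ.+ j ] ⊗ (y ^ suc (n ℕ.+ j)) ∣≤_) (^ℚ-+ Y (suc n) j)
                   (bound-1/[1+n]⊗ (n ℕ.+ j) (bound-^ ∣y∣≤Y (suc (n ℕ.+ j))))))
  where
  tail = Σ< m (λ j → fromℚ 1/[1+ n ℕ.+ j ] ⊗ (y ^ suc (n ℕ.+ j)))
  difference≡tail : logSeries (n ℕ.+ m) y ⊖ logSeries n y ≡ tail
  difference≡tail = trans (cong (_⊖ logSeries n y) (Σ-+ n m _)) (solve 2 (λ l t → (l :+ t) :- l := t) refl (logSeries n y) tail)
    where open ℚ√5-Solver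

defect : ℕ → ℚ√5 → ℚ√5 → ℚ√5
defect N x y = logSeries N (x ⋆ y) ⊖ (logSeries N x ⊕ logSeries N y)

-- The recursion  Qⁿ⁺¹ₖ = s Qⁿₖ₋₁ + p Qⁿₖ₋₂  keeps |Qⁿₖ| ≤ σᵏ μⁿ under the two hypotheses on A + B and A B;
-- summing geometric series over n and then over k bounds the tail in logSeries-⋆.
module LogProductBound {x y : ℚ√5} {A B σ μ Gσ Gμ : ℚ}
  (∣x∣≤A : ∣ x ∣≤ A) (∣y∣≤B : ∣ y ∣≤ B) (0≤σ : 0ℚ ≤ σ) (0≤μ : 0ℚ ≤ μ)
  (A+B≤μσ : A + B ≤ μ * σ) (AB+[A+B]σ≤μσ² : (A + B) * σ + A * B ≤ μ * (σ * σ))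
  (0≤Gσ : 0ℚ ≤ Gσ) (1≤Gσ[1-σ] : 1ℚ ≤ Gσ * (1ℚ - σ)) (0≤Gμ : 0ℚ ≤ Gμ) (1≤Gμ[1-μ] : 1ℚ ≤ Gμ * (1ℚ - μ)) where

  open LogProduct x y

  private
    ∣s∣≤ : ∣ s ∣≤ A + B
    ∣s∣≤ = bound-⊕ ∣x∣≤A ∣y∣≤B
    ∣p∣≤ : ∣ p ∣≤ A * B
    ∣p∣≤ = bound-neg (bound-⊗ ∣x∣≤A ∣y∣≤B)

  bound-Q^ : ∀ n k → ∣ (Q^ n) k ∣≤ σ ^ℚ k * μ ^ℚ n
  bound-Q^ zero    zero          = bound-fromℚ (≤-decide 0ℚ (1ℚ * 1ℚ - 1ℚ)) (≤-decide 0ℚ (1ℚ * 1ℚ + 1ℚ))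
  bound-Q^ zero    (suc k)       = bound-0q (nonNeg*nonNeg (^ℚ-nonNeg 0≤σ (suc k)) (≤-decide 0ℚ 1ℚ))
  bound-Q^ (suc n) zero          = subst (∣_∣≤ _) (sym (⟨⟩·-0 s p zero)) (bound-0q (nonNeg*nonNeg (≤-decide 0ℚ 1ℚ) (^ℚ-nonNeg 0≤μ (suc n))))
  bound-Q^ (suc n) (suc zero)    = bound-mono (0≤q-p⇒p≤q (subst (0ℚ ≤_) (sym (slack σ μ A B (μ ^ℚ n)))
                                     (nonNeg*nonNeg (p≤q⇒0≤q-p A+B≤μσ) (^ℚ-nonNeg 0≤μ n))))
                                     (bound-⊕ (bound-⊗ ∣s∣≤ (bound-Q^ n 0)) (bound-⊗ ∣p∣≤ (bound-0q ℚ.≤-refl)))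
    where
    open +-*-Solver
    slack : ∀ σ μ A B m → (σ * 1ℚ) * (μ * m) - ((A + B) * (1ℚ * m) + (A * B) * 0ℚ) ≡ (μ * σ - (A + B)) * m
    slack = solve 5 (λ σ μ A B m → (σ :* con 1ℚ) :* (μ :* m) :- ((A :+ B) :* (con 1ℚ :* m) :+ (A :* B) :* con 0ℚ)
                                := (μ :* σ :- (A :+ B)) :* m) refl
  bound-Q^ (suc n) (suc (suc k)) = bound-mono (0≤q-p⇒p≤q (subst (0ℚ ≤_) (sym (slack σ μ A B (σ ^ℚ k) (μ ^ℚ n)))
                                     (nonNeg*nonNeg (nonNeg*nonNeg (p≤q⇒0≤q-p AB+[A+B]σ≤μσ²) (^ℚ-nonNeg 0≤σ k)) (^ℚ-nonNeg 0≤μ n))))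
                                     (bound-⊕ (bound-⊗ ∣s∣≤ (bound-Q^ n (suc k))) (bound-⊗ ∣p∣≤ (bound-Q^ n k)))
    where
    open +-*-Solver
    slack : ∀ σ μ A B x m → (σ * (σ * x)) * (μ * m) - ((A + B) * ((σ * x) * m) + (A * B) * (x * m))
                          ≡ ((μ * (σ * σ) - ((A + B) * σ + A * B)) * x) * m
    slack = solve 6 (λ σ μ A B x m → (σ :* (σ :* x)) :* (μ :* m) :- ((A :+ B) :* ((σ :* x) :* m) :+ (A :* B) :* (x :* m))
                                  := ((μ :* (σ :* σ) :- ((A :+ B) :* σ :+ A :* B)) :* x) :* m) refl

  bound-logQ : ∀ N k → ∣ logQ N k ∣≤ Gμ * (σ ^ℚ k * μ)
  bound-logQ N k = bound-Σ-geometric N _ 0≤μ (nonNeg*nonNeg (^ℚ-nonNeg 0≤σ k) 0≤μ) 0≤Gμ 1≤Gμ[1-μ]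
    (λ n _ → subst (∣ fromℚ 1/[1+ n ] ⊗ (Q^ suc n) k ∣≤_) (sym (ℚ.*-assoc (σ ^ℚ k) μ (μ ^ℚ n)))
                   (bound-1/[1+n]⊗ n (bound-Q^ (suc n) k)))

  logSeries-⋆-defect : ∀ N → ∣ defect N x y ∣≤ Gσ * (Gμ * (σ ^ℚ suc N * μ))
  logSeries-⋆-defect N = subst (∣_∣≤ _) (sym defect≡tail)
    (bound-Σ-geometric N _ 0≤σ (nonNeg*nonNeg 0≤Gμ (nonNeg*nonNeg (^ℚ-nonNeg 0≤σ (suc N)) 0≤μ)) 0≤Gσ 1≤Gσ[1-σ]
      (λ j _ → subst (∣ logQ N (suc N ℕ.+ j) ∣≤_) (reassoc j) (bound-logQ N (suc N ℕ.+ j))))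
    where
    tail = Σ< N (λ j → logQ N (suc N ℕ.+ j))
    defect≡tail : logSeries N (x ⋆ y) ⊖ (logSeries N x ⊕ logSeries N y) ≡ tail
    defect≡tail = trans (cong (_⊖ (logSeries N x ⊕ logSeries N y)) (logSeries-⋆ N))
                        (solve 2 (λ l t → (l :+ t) :- l := t) refl (logSeries N x ⊕ logSeries N y) tail)
      where open ℚ√5-Solver
    reassoc : ∀ j → Gμ * (σ ^ℚ (suc N ℕ.+ j) * μ) ≡ Gμ * (σ ^ℚ suc N * μ) * σ ^ℚ j
    reassoc j = trans (cong (λ z → Gμ * (z * μ)) (^ℚ-+ σ (suc N) j)) (regroup Gμ (σ ^ℚ suc N) (σ ^ℚ j) μ)
      where
      open +-*-Solver
      regroup : ∀ G a b m → G * ((a * b) * m) ≡ G * (a * m) * b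
      regroup = solve 4 (λ G a b m → G :* ((a :* b) :* m) := G :* (a :* m) :* b) refl

-- The series of the theorem

recip-α^2n : ∀ n → recip (α ^ (2 ℕ.* n)) ≡ β ^ (2 ℕ.* n)
recip-α^2n n = recip-unique (α ^ (2 ℕ.* n)) (β ^ (2 ℕ.* n)) (begin
  (α ^ (2 ℕ.* n)) ⊗ (β ^ (2 ℕ.* n))   ≡⟨ sym (^-distrib-⊗ α β (2 ℕ.* n)) ⟩
  (α ⊗ β) ^ (2 ℕ.* n)                 ≡⟨ sym (^-* (α ⊗ β) 2 n) ⟩
  ((α ⊗ β) ^ 2) ^ n                   ≡⟨ 1^ n ⟩
  1q                                  ∎)
  where open ≡-Reasoning

atom : ℕ → ℕ → ℚ√5
atom n i = fromℚ 1/[1+ 12 ℕ.* n ℕ.+ i ] ⊗ (β ^ suc (12 ℕ.* n ℕ.+ i))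

β⊗term : ∀ n → β ⊗ term n ≡ Σ< 12 (λ i → fromℚ (c i /ℚ 1) ⊗ atom n i)
β⊗term n = begin
  β ⊗ term n                                                   ≡⟨ cong (λ z → β ⊗ (z ⊗ inner n)) (trans (cong (λ m → recip (α ^ m)) 12n≡2[6n]) (recip-α^2n (6 ℕ.* n))) ⟩
  β ⊗ ((β ^ (2 ℕ.* (6 ℕ.* n))) ⊗ inner n)                      ≡⟨ cong (λ z → β ⊗ ((β ^ z) ⊗ inner n)) (sym 12n≡2[6n]) ⟩
  β ⊗ ((β ^ (12 ℕ.* n)) ⊗ inner n)                             ≡⟨ cong (β ⊗_) (sym (Σ-⊗ˡ 12 (β ^ (12 ℕ.* n)) (λ i → r i ⊗ a i))) ⟩
  β ⊗ Σ< 12 (λ i → (β ^ (12 ℕ.* n)) ⊗ (r i ⊗ a i))             ≡⟨ sym (Σ-⊗ˡ 12 β (λ i → (β ^ (12 ℕ.* n)) ⊗ (r i ⊗ a i))) ⟩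
  Σ< 12 (λ i → β ⊗ ((β ^ (12 ℕ.* n)) ⊗ (r i ⊗ a i)))          ≡⟨ Σ-cong 12 (λ i _ → per-term i) ⟩
  Σ< 12 (λ i → fromℚ (c i /ℚ 1) ⊗ atom n i)                    ∎
  where
  open ≡-Reasoning
  12n≡2[6n] : 12 ℕ.* n ≡ 2 ℕ.* (6 ℕ.* n)
  12n≡2[6n] = ℕ.*-assoc 2 6 n
  r : ℕ → ℚ√5
  r i = fromℚ 1/[1+ 12 ℕ.* n ℕ.+ i ]
  per-term : ∀ i → β ⊗ ((β ^ (12 ℕ.* n)) ⊗ (r i ⊗ a i)) ≡ fromℚ (c i /ℚ 1) ⊗ atom n i
  per-term i = trans (regroup β (β ^ (12 ℕ.* n)) (r i) (fromℚ (c i /ℚ 1)) (β ^ i))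
                     (cong (λ z → fromℚ (c i /ℚ 1) ⊗ (r i ⊗ (β ⊗ z))) (sym (^-+ β (12 ℕ.* n) i)))
    where
    open ℚ√5-Solver
    regroup : ∀ b B r c bⁱ → b ⊗ (B ⊗ (r ⊗ (c ⊗ bⁱ))) ≡ c ⊗ (r ⊗ (b ⊗ (B ⊗ bⁱ)))
    regroup = solve 5 (λ b B r c bⁱ → b :* (B :* (r :* (c :* bⁱ))) := c :* (r :* (b :* (B :* bⁱ)))) refl

-- logSeries (d n) (βᵉ), the part of  Σ_{m ≤ 12 n} βᵐ/m  supported on multiples of e = 12/d, scaled by e.
Lβ : ℕ → ℕ → ℕ → ℚ√5
Lβ e d n = logSeries (d ℕ.* n) (β ^ e)

Lβ-suc : ∀ e′ d n → suc e′ ℕ.* d ≡ 12 →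
         Lβ (suc e′) d (suc n) ≡ Lβ (suc e′) d n ⊕ Σ< d (λ i → ℕ→ℚ√5 (suc e′) ⊗ atom n (e′ ℕ.+ suc e′ ℕ.* i))
Lβ-suc e′ d n ed≡12 = begin
  Lβ e d (suc n)                                                     ≡⟨ cong (λ l → logSeries l (β ^ e)) (trans (ℕ.*-suc d n) (ℕ.+-comm d (d ℕ.* n))) ⟩
  logSeries (d ℕ.* n ℕ.+ d) (β ^ e)                                  ≡⟨ Σ-+ (d ℕ.* n) d _ ⟩
  Lβ e d n ⊕ Σ< d (λ i → fromℚ 1/[1+ m i ] ⊗ ((β ^ e) ^ suc (m i)))   ≡⟨ cong (Lβ e d n ⊕_) (Σ-cong d (λ i _ → per-term i)) ⟩
  Lβ e d n ⊕ Σ< d (λ i → ℕ→ℚ√5 e ⊗ atom n (e′ ℕ.+ e ℕ.* i))          ∎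
  where
  open ≡-Reasoning
  e = suc e′
  m : ℕ → ℕ
  m i = d ℕ.* n ℕ.+ i
  j : ℕ → ℕ
  j i = 12 ℕ.* n ℕ.+ (e′ ℕ.+ e ℕ.* i)
  e[1+m]≡1+j : ∀ i → e ℕ.* suc (m i) ≡ suc (j i)
  e[1+m]≡1+j i = trans (expand e d n i) (trans (cong (λ z → z ℕ.* n ℕ.+ e ℕ.* suc i) ed≡12) (regroup e′ i (12 ℕ.* n)))
    where
    expand : ∀ e d n i → e ℕ.* suc (d ℕ.* n ℕ.+ i) ≡ (e ℕ.* d) ℕ.* n ℕ.+ e ℕ.* suc i
    expand = solve-∀
    regroup : ∀ e′ i t → t ℕ.+ suc e′ ℕ.* suc i ≡ suc (t ℕ.+ (e′ ℕ.+ suc e′ ℕ.* i))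
    regroup = solve-∀
  per-term : ∀ i → fromℚ 1/[1+ m i ] ⊗ ((β ^ e) ^ suc (m i)) ≡ ℕ→ℚ√5 e ⊗ atom n (e′ ℕ.+ e ℕ.* i)
  per-term i = begin
    fromℚ 1/[1+ m i ] ⊗ ((β ^ e) ^ suc (m i))                          ≡⟨ cong₂ _⊗_ (cong fromℚ (1/[1+n]-scale e (m i) (j i) (e[1+m]≡1+j i)))
                                                                                      (trans (^-* β e (suc (m i))) (cong (β ^_) (e[1+m]≡1+j i))) ⟩
    fromℚ (ℕ→ℚ e * 1/[1+ j i ]) ⊗ (β ^ suc (j i))                      ≡⟨ cong (_⊗ (β ^ suc (j i))) (fromℚ-* (ℕ→ℚ e) 1/[1+ j i ]) ⟩
    (ℕ→ℚ√5 e ⊗ fromℚ 1/[1+ j i ]) ⊗ (β ^ suc (j i))                    ≡⟨ ⊗-assoc (ℕ→ℚ√5 e) (fromℚ 1/[1+ j i ]) (β ^ suc (j i)) ⟩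
    ℕ→ℚ√5 e ⊗ atom n (e′ ℕ.+ e ℕ.* i)                                  ∎

block : (ℕ → ℚ√5) → ℕ → ℕ → ℚ√5
block v e′ d = Σ< d (λ i → ℕ→ℚ√5 (suc e′) ⊗ v (e′ ℕ.+ suc e′ ℕ.* i))

-- cᵢ = 1 - 3 [3 ∣ i + 1] + 4 [4 ∣ i + 1] + 12 [6 ∣ i + 1] - 12 [12 ∣ i + 1]
coefficient-decomposition : ∀ v → Σ< 12 (λ i → fromℚ (c i /ℚ 1) ⊗ v i)
                   ≡ (((block v 0 12 ⊖ block v 2 4) ⊕ block v 3 3) ⊕ (block v 5 2 ⊕ block v 5 2)) ⊖ block v 11 1
coefficient-decomposition v = solve 12 (λ v₀ v₁ v₂ v₃ v₄ v₅ v₆ v₇ v₈ v₉ v₁₀ v₁₁ →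
      Σᴾ (map c′ ((c 0 , v₀) ∷ (c 1 , v₁) ∷ (c 2 , v₂) ∷ (c 3 , v₃) ∷ (c 4 , v₄) ∷ (c 5 , v₅)
                ∷ (c 6 , v₆) ∷ (c 7 , v₇) ∷ (c 8 , v₈) ∷ (c 9 , v₉) ∷ (c 10 , v₁₀) ∷ (c 11 , v₁₁) ∷ []))
   := (((Σᴾ (map (e′ 1) (v₀ ∷ v₁ ∷ v₂ ∷ v₃ ∷ v₄ ∷ v₅ ∷ v₆ ∷ v₇ ∷ v₈ ∷ v₉ ∷ v₁₀ ∷ v₁₁ ∷ [])) :- Σᴾ (map (e′ 3) (v₂ ∷ v₅ ∷ v₈ ∷ v₁₁ ∷ [])))
         :+ Σᴾ (map (e′ 4) (v₃ ∷ v₇ ∷ v₁₁ ∷ [])))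
        :+ (Σᴾ (map (e′ 6) (v₅ ∷ v₁₁ ∷ [])) :+ Σᴾ (map (e′ 6) (v₅ ∷ v₁₁ ∷ []))))
      :- Σᴾ (map (e′ 12) (v₁₁ ∷ []))) refl
  (v 0) (v 1) (v 2) (v 3) (v 4) (v 5) (v 6) (v 7) (v 8) (v 9) (v 10) (v 11)
  where
  open ℚ√5-Solver
  Σᴾ : List (Polynomial 12) → Polynomial 12
  Σᴾ = foldl _:+_ (con 0q)
  c′ : ℤ.ℤ × Polynomial 12 → Polynomial 12
  c′ (cᵢ , vᵢ) = con (fromℚ (cᵢ /ℚ 1)) :* vᵢ
  e′ : ℕ → Polynomial 12 → Polynomial 12
  e′ e vᵢ = con (ℕ→ℚ√5 e) :* vᵢ

logCombination : ℕ → ℚ√5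
logCombination n = (((Lβ 1 12 n ⊖ Lβ 3 4 n) ⊕ Lβ 4 3 n) ⊕ (Lβ 6 2 n ⊕ Lβ 6 2 n)) ⊖ Lβ 12 1 n

β⊗S : ∀ n → β ⊗ S n ≡ logCombination n
β⊗S zero    = refl
β⊗S (suc n) = begin
  β ⊗ (S n ⊕ term n)                                    ≡⟨ ⊗-distribˡ-⊕ β (S n) (term n) ⟩
  (β ⊗ S n) ⊕ (β ⊗ term n)                              ≡⟨ cong₂ _⊕_ (β⊗S n) (trans (β⊗term n) (coefficient-decomposition (atom n))) ⟩
  logCombination n ⊕ ((((b 0 12 ⊖ b 2 4) ⊕ b 3 3) ⊕ (b 5 2 ⊕ b 5 2)) ⊖ b 11 1)
                                                        ≡⟨ regroup (Lβ 1 12 n) (Lβ 3 4 n) (Lβ 4 3 n) (Lβ 6 2 n) (Lβ 12 1 n) (b 0 12) (b 2 4) (b 3 3) (b 5 2) (b 11 1) ⟩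
  (((((Lβ 1 12 n ⊕ b 0 12) ⊖ (Lβ 3 4 n ⊕ b 2 4)) ⊕ (Lβ 4 3 n ⊕ b 3 3)) ⊕ ((Lβ 6 2 n ⊕ b 5 2) ⊕ (Lβ 6 2 n ⊕ b 5 2))) ⊖ (Lβ 12 1 n ⊕ b 11 1))
                                                        ≡⟨ sym (cong₂ _⊖_ (cong₂ _⊕_ (cong₂ _⊕_ (cong₂ _⊖_ (Lβ-suc 0 12 n refl) (Lβ-suc 2 4 n refl)) (Lβ-suc 3 3 n refl))
                                                                                      (cong₂ _⊕_ (Lβ-suc 5 2 n refl) (Lβ-suc 5 2 n refl)))
                                                                          (Lβ-suc 11 1 n refl)) ⟩
  logCombination (suc n)                                ∎
  where
  open ≡-Reasoning
  b = block (atom n)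
  open ℚ√5-Solver
  regroup : ∀ L₁ L₃ L₄ L₆ L₁₂ b₁ b₃ b₄ b₆ b₁₂ →
            ((((L₁ ⊖ L₃) ⊕ L₄) ⊕ (L₆ ⊕ L₆)) ⊖ L₁₂) ⊕ ((((b₁ ⊖ b₃) ⊕ b₄) ⊕ (b₆ ⊕ b₆)) ⊖ b₁₂)
          ≡ ((((L₁ ⊕ b₁) ⊖ (L₃ ⊕ b₃)) ⊕ (L₄ ⊕ b₄)) ⊕ ((L₆ ⊕ b₆) ⊕ (L₆ ⊕ b₆))) ⊖ (L₁₂ ⊕ b₁₂)
  regroup = solve 10 (λ L₁ L₃ L₄ L₆ L₁₂ b₁ b₃ b₄ b₆ b₁₂ →
            ((((L₁ :- L₃) :+ L₄) :+ (L₆ :+ L₆)) :- L₁₂) :+ ((((b₁ :- b₃) :+ b₄) :+ (b₆ :+ b₆)) :- b₁₂)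
         := ((((L₁ :+ b₁) :- (L₃ :+ b₃)) :+ (L₄ :+ b₄)) :+ ((L₆ :+ b₆) :+ (L₆ :+ b₆))) :- (L₁₂ :+ b₁₂)) refl

σ : ℚ
σ = + 9 /ℚ 10

0≤σ : 0ℚ ≤ σ
0≤σ = ≤-decide 0ℚ σ

bound-defect : ∀ {x y A B} → ∣ x ∣≤ A → ∣ y ∣≤ B →
               {True (A + B ℚ.≤? (+ 99 /ℚ 100) * σ)} → {True ((A + B) * σ + A * B ℚ.≤? (+ 99 /ℚ 100) * (σ * σ))} →
               ∀ N → ∣ defect N x y ∣≤ (+ 990 /ℚ 1) * σ ^ℚ suc N
bound-defect {x} {y} {A} {B} ∣x∣≤A ∣y∣≤B {A+B≤μσ} {[A+B]σ+AB≤μσ²} N = subst (∣ defect N x y ∣≤_) (constant (σ ^ℚ suc N))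
  (LogProductBound.logSeries-⋆-defect {μ = + 99 /ℚ 100} {+ 10 /ℚ 1} {+ 100 /ℚ 1}
     ∣x∣≤A ∣y∣≤B 0≤σ (≤-decide 0ℚ (+ 99 /ℚ 100)) (toWitness A+B≤μσ) (toWitness [A+B]σ+AB≤μσ²)
     (≤-decide 0ℚ (+ 10 /ℚ 1)) (≤-decide 1ℚ ((+ 10 /ℚ 1) * (1ℚ - σ)))
     (≤-decide 0ℚ (+ 100 /ℚ 1)) (≤-decide 1ℚ ((+ 100 /ℚ 1) * (1ℚ - + 99 /ℚ 100))) N)
  where
  open +-*-Solver
  constant : ∀ s → (+ 10 /ℚ 1) * ((+ 100 /ℚ 1) * (s * (+ 99 /ℚ 100))) ≡ (+ 990 /ℚ 1) * s
  constant = solve 1 (λ s → con (+ 10 /ℚ 1) :* (con (+ 100 /ℚ 1) :* (s :* con (+ 99 /ℚ 100))) := con (+ 990 /ℚ 1) :* s) refl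

bound-logSeries-tail-σ : ∀ {y} d → ∣ y ∣≤ σ → ∀ n → ∣ logSeries (suc d ℕ.* n) y ⊖ logSeries n y ∣≤ (+ 10 /ℚ 1) * σ ^ℚ suc n
bound-logSeries-tail-σ d ∣y∣≤σ n = bound-logSeries-tail n (d ℕ.* n) ∣y∣≤σ 0≤σ (≤-decide 0ℚ (+ 10 /ℚ 1)) (≤-decide 1ℚ ((+ 10 /ℚ 1) * (1ℚ - σ)))

u₁ u₂ : ℚ√5
u₁ = (β ^ 1) ⋆ (β ^ 4)
u₂ = u₁ ⋆ (β ^ 6)

-- (1 - β)(1 - β⁴)(1 - β⁶)² = (1 - β³)(1 - β¹²): the multiplicative relation behind the theorem.
⋆-relation : u₂ ⋆ (β ^ 6) ≡ (β ^ 3) ⋆ (β ^ 12)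
⋆-relation = refl

∣β^1∣≤ : ∣ β ^ 1 ∣≤ + 5 /ℚ 8
∣β^1∣≤ = bound-decide (β ^ 1) (+ 5 /ℚ 8) 3
∣β^3∣≤ : ∣ β ^ 3 ∣≤ + 1 /ℚ 4
∣β^3∣≤ = bound-decide (β ^ 3) (+ 1 /ℚ 4) 3
∣β^4∣≤ : ∣ β ^ 4 ∣≤ + 3 /ℚ 20
∣β^4∣≤ = bound-decide (β ^ 4) (+ 3 /ℚ 20) 3
∣β^6∣≤ : ∣ β ^ 6 ∣≤ + 3 /ℚ 50
∣β^6∣≤ = bound-decide (β ^ 6) (+ 3 /ℚ 50) 3
∣β^12∣≤ : ∣ β ^ 12 ∣≤ + 1 /ℚ 100
∣β^12∣≤ = bound-decide (β ^ 12) (+ 1 /ℚ 100) 3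
∣u₁∣≤ : ∣ u₁ ∣≤ + 2 /ℚ 5
∣u₁∣≤ = bound-decide u₁ (+ 2 /ℚ 5) 3
∣u₂∣≤ : ∣ u₂ ∣≤ + 1 /ℚ 3
∣u₂∣≤ = bound-decide u₂ (+ 1 /ℚ 3) 3

logCombination-split : ∀ n → logCombination n ≡
  (((((Lβ 1 12 n ⊖ logSeries n (β ^ 1)) ⊖ (Lβ 3 4 n ⊖ logSeries n (β ^ 3))) ⊕ (Lβ 4 3 n ⊖ logSeries n (β ^ 4)))
     ⊕ ((Lβ 6 2 n ⊖ logSeries n (β ^ 6)) ⊕ (Lβ 6 2 n ⊖ logSeries n (β ^ 6))))
   ⊕ (((defect n (β ^ 3) (β ^ 12) ⊖ defect n (β ^ 1) (β ^ 4)) ⊖ defect n u₁ (β ^ 6)) ⊖ defect n u₂ (β ^ 6)))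
logCombination-split n = begin
  logCombination n                                         ≡⟨ cong (λ l → (((M₁ ⊖ M₃) ⊕ M₄) ⊕ (M₆ ⊕ M₆)) ⊖ logSeries l (β ^ 12)) (ℕ.*-identityˡ n) ⟩
  (((M₁ ⊖ M₃) ⊕ M₄) ⊕ (M₆ ⊕ M₆)) ⊖ L (β ^ 12)              ≡⟨ regroup M₁ M₃ M₄ M₆ (L (β ^ 1)) (L (β ^ 3)) (L (β ^ 4)) (L (β ^ 6)) (L (β ^ 12)) (L u₁) (L u₂) (L (u₂ ⋆ (β ^ 6))) ⟩
  tails ⊕ ((((L (u₂ ⋆ (β ^ 6)) ⊖ (L (β ^ 3) ⊕ L (β ^ 12))) ⊖ defect n (β ^ 1) (β ^ 4)) ⊖ defect n u₁ (β ^ 6)) ⊖ defect n u₂ (β ^ 6))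
                                                           ≡⟨ cong (λ z → tails ⊕ ((((L z ⊖ (L (β ^ 3) ⊕ L (β ^ 12))) ⊖ defect n (β ^ 1) (β ^ 4)) ⊖ defect n u₁ (β ^ 6)) ⊖ defect n u₂ (β ^ 6))) ⋆-relation ⟩
  tails ⊕ (((defect n (β ^ 3) (β ^ 12) ⊖ defect n (β ^ 1) (β ^ 4)) ⊖ defect n u₁ (β ^ 6)) ⊖ defect n u₂ (β ^ 6)) ∎
  where
  open ≡-Reasoning
  L = logSeries n
  M₁ = Lβ 1 12 n
  M₃ = Lβ 3 4 n
  M₄ = Lβ 4 3 n
  M₆ = Lβ 6 2 n
  tails = (((M₁ ⊖ L (β ^ 1)) ⊖ (M₃ ⊖ L (β ^ 3))) ⊕ (M₄ ⊖ L (β ^ 4))) ⊕ ((M₆ ⊖ L (β ^ 6)) ⊕ (M₆ ⊖ L (β ^ 6)))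
  open ℚ√5-Solver
  regroup : ∀ M₁ M₃ M₄ M₆ L₁ L₃ L₄ L₆ L₁₂ Lu₁ Lu₂ Lu₃ →
    (((M₁ ⊖ M₃) ⊕ M₄) ⊕ (M₆ ⊕ M₆)) ⊖ L₁₂ ≡
    (((((M₁ ⊖ L₁) ⊖ (M₃ ⊖ L₃)) ⊕ (M₄ ⊖ L₄)) ⊕ ((M₆ ⊖ L₆) ⊕ (M₆ ⊖ L₆)))
     ⊕ ((((Lu₃ ⊖ (L₃ ⊕ L₁₂)) ⊖ (Lu₁ ⊖ (L₁ ⊕ L₄))) ⊖ (Lu₂ ⊖ (Lu₁ ⊕ L₆))) ⊖ (Lu₃ ⊖ (Lu₂ ⊕ L₆))))
  regroup = solve 12 (λ M₁ M₃ M₄ M₆ L₁ L₃ L₄ L₆ L₁₂ Lu₁ Lu₂ Lu₃ →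
    (((M₁ :- M₃) :+ M₄) :+ (M₆ :+ M₆)) :- L₁₂ :=
    (((((M₁ :- L₁) :- (M₃ :- L₃)) :+ (M₄ :- L₄)) :+ ((M₆ :- L₆) :+ (M₆ :- L₆)))
     :+ ((((Lu₃ :- (L₃ :+ L₁₂)) :- (Lu₁ :- (L₁ :+ L₄))) :- (Lu₂ :- (Lu₁ :+ L₆))) :- (Lu₃ :- (Lu₂ :+ L₆))))) refl

bound-logCombination : ∀ n → ∣ logCombination n ∣≤ (+ 4010 /ℚ 1) * σ ^ℚ suc n
bound-logCombination n = subst (∣_∣≤ (+ 4010 /ℚ 1) * σ ^ℚ suc n) (sym (logCombination-split n)) (bound-mono (ℚ.≤-reflexive total)
  (bound-⊕ (bound-⊕ (bound-⊕ (bound-⊖ (bound-logSeries-tail-σ 11 (≤σ ∣β^1∣≤) n) (bound-logSeries-tail-σ 3 (≤σ ∣β^3∣≤) n)) (bound-logSeries-tail-σ 2 (≤σ ∣β^4∣≤) n))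
                    (bound-⊕ (bound-logSeries-tail-σ 1 (≤σ ∣β^6∣≤) n) (bound-logSeries-tail-σ 1 (≤σ ∣β^6∣≤) n)))
           (bound-⊖ (bound-⊖ (bound-⊖ (bound-defect ∣β^3∣≤ ∣β^12∣≤ n) (bound-defect ∣β^1∣≤ ∣β^4∣≤ n)) (bound-defect ∣u₁∣≤ ∣β^6∣≤ n))
                    (bound-defect ∣u₂∣≤ ∣β^6∣≤ n))))
  where
  ≤σ : ∀ {y A} → ∣ y ∣≤ A → {True (A ℚ.≤? σ)} → ∣ y ∣≤ σ
  ≤σ ∣y∣≤A {A≤σ} = bound-mono (toWitness A≤σ) ∣y∣≤A
  open +-*-Solver
  T D : ℚ
  T = (+ 10 /ℚ 1) * σ ^ℚ suc n
  D = (+ 990 /ℚ 1) * σ ^ℚ suc n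
  total : (((T + T) + T) + (T + T)) + (((D + D) + D) + D) ≡ (+ 4010 /ℚ 1) * σ ^ℚ suc n
  total = solve 1 (λ s → let t = con (+ 10 /ℚ 1) :* s ; d = con (+ 990 /ℚ 1) :* s in
                         (((t :+ t) :+ t) :+ (t :+ t)) :+ (((d :+ d) :+ d) :+ d) := con (+ 4010 /ℚ 1) :* s) refl (σ ^ℚ suc n)

bound-S : ∀ n → ∣ S n ∣≤ (+ 8020 /ℚ 1) * σ ^ℚ suc n
bound-S n = subst₂ ∣_∣≤_ (sym S≡-α⊗β⊗S) (sym (ℚ.*-assoc (+ 2 /ℚ 1) (+ 4010 /ℚ 1) (σ ^ℚ suc n)))
  (bound-neg (bound-⊗ (bound-decide α (+ 2 /ℚ 1) 3) (subst (∣_∣≤ (+ 4010 /ℚ 1) * σ ^ℚ suc n) (sym (β⊗S n)) (bound-logCombination n))))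
  where
  S≡-α⊗β⊗S : S n ≡ ⊖ (α ⊗ (β ⊗ S n))
  S≡-α⊗β⊗S = trans (solve 1 (λ x → x := :- ((con α :* con β) :* x)) refl (S n)) (cong (⊖_) (⊗-assoc α β (S n)))
    where open ℚ√5-Solver

theorem5p6 : SeriesSumsTo term 0q
theorem5p6 δ 0<δ = N , λ n N≤n → bound⇒AbsLt (subst (∣_∣≤ _) (sym (⊕-identityʳ (S n))) (bound-mono (decay N≤n) (bound-S n))) C*σᴺ<δ
  where
  C = + 8020 /ℚ 1
  eventually = ^ℚ-eventually-< 0≤σ (<-decide σ 1ℚ) (≤-decide 0ℚ C) 0<δ
  N = proj₁ eventually
  C*σᴺ<δ = proj₂ eventually
  decay : ∀ {n} → N ℕ.≤ n → C * σ ^ℚ suc n ≤ C * σ ^ℚ N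
  decay N≤n = ℚ.*-monoˡ-≤-nonNeg C {{ℚ.nonNegative (≤-decide 0ℚ C)}} (^ℚ-antitone 0≤σ (≤-decide σ 1ℚ) (ℕ.m≤n⇒m≤1+n N≤n))
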